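{- Let $l,m,k$ be nonnegative integers with $k\le m$, and let $[l]\times[m]=B(m,\dots,m)$ be the rectangular board with $l$ columns of height $m$. Then $$r_k(a;q;[l]\times[m])=q^{\binom{k+1}{2}-lm}\begin{bmatrix}l\\k\end{bmatrix}_q\frac{[m]_q!}{[m-k]_q!}\,\frac{(aq^{l-m-k};q)_k\,(aq^{1+2l-2m};q^2)_{m-k}}{(aq^{1-2m};q^2)_m}.$$
   Context: Notation: $(x;q)_n=\prod_{i=0}^{n-1}(1-xq^i)$, $[n]_q=\frac{1-q^n}{1-q}$, $[n]_q!=[n]_q[n-1]_q\cdots[1]_q$, and the $q$-binomial coefficient $\begin{bmatrix}l\\k\end{bmatrix}_q=\frac{[l]_q!}{[k]_q![l-k]_q!}$ for $0\le k\le l$ and $0$ for $k>l$. The $a;q$-weight is $w_{a;q}(k)=\frac{1-aq^{2k+1}}{1-aq^{2k-1}}q^{ -1}$ ($a,q$ generic). Cells $(i,j)$: column $i$, row $j$. For a board $B$, $\mathcal N_k(B)$ is the set of placements of $k$ nonattacking rooks (no two in a row or column); each rook cancels all cells of $B$ strictly to its right in its row and strictly below it in its column; $U_B(P)$ is the set of cells neither cancelled nor occupied; $r_{(i,j)}(P)$ is the number of rooks of $P$ in cells $(i',j')$ with $i'<i$, $j'>j$. The $a;q$-rook number is $r_k(a;q;B)=\sum_{P\in\mathcal N_k(B)}\prod_{(i,j)\in U_B(P)}w_{a;q}(i-j-r_{(i,j)}(P))$ (this is the limit $p\to0$ followed by $b\to0$ of the elliptic rook number). -}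

module Defs where

open import Level using (Level; _⊔_) renaming (suc to lsuc)
open import Algebra.Bundles using (CommutativeRing)
open import Data.Nat as ℕ using (ℕ; zero; suc; _∸_; _<ᵇ_)
open import Data.Integer as ℤ using (ℤ; +_; -[1+_])
open import Data.Bool using () renaming (_≟_ to _≟ᵇ_)
open import Data.Bool using (Bool; true; false; if_then_else_; _∧_; _∨_; not)
open import Data.Maybe using (Maybe; just; nothing)
open import Data.Fin as Fin using (Fin; toℕ)
open import Data.Vec as Vec using (Vec; []; _∷_; lookup)
open import Data.List as List using (List; []; _∷_; _++_; map; filter; concatMap; foldr; allFin; length)
open import Relation.Nullary using (¬_)
open import Data.Bool.ListAction using (any)
open import Data.Product using (_×_; _,_; proj₁; proj₂)
open import Relation.Nullary.Decidable using (does)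
open import Relation.Binary.PropositionalEquality using (_≡_)

record Field (c ℓ : Level) : Set (lsuc (c ⊔ ℓ)) where
  field
    commutativeRing : CommutativeRing c ℓ
  open CommutativeRing commutativeRing public
  field
    _⁻¹ : Carrier → Carrier
    ⁻¹-inverseʳ : ∀ x → ¬ (x ≈ 0#) → (x * (x ⁻¹)) ≈ 1#
    ⁻¹-cong : ∀ {x y} → x ≈ y → (x ⁻¹) ≈ (y ⁻¹)
    0≉1 : ¬ (0# ≈ 1#)

module FieldOps {c ℓ} (K : Field c ℓ) where
  open Field K

  _/_ : Carrier → Carrier → Carrier
  x / y = x * (y ⁻¹)

  _^_ : Carrier → ℕ → Carrier
  x ^ zero = 1#
  x ^ suc n = x * (x ^ n)

  _^ᶻ_ : Carrier → ℤ → Carrier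
  x ^ᶻ (+ n) = x ^ n
  x ^ᶻ -[1+ n ] = (x ⁻¹) ^ suc n

  sumL : List Carrier → Carrier
  sumL = foldr _+_ 0#

  prodL : List Carrier → Carrier
  prodL = foldr _*_ 1#

  poch : Carrier → Carrier → ℕ → Carrier
  poch x b zero = 1#
  poch x b (suc n) = poch x b n * (1# - x * (b ^ n))

  qint : Carrier → ℕ → Carrier
  qint q n = (1# - q ^ n) / (1# - q)

  qfact : Carrier → ℕ → Carrier
  qfact q zero = 1#
  qfact q (suc n) = qint q (suc n) * qfact q n

  qbinom : Carrier → ℕ → ℕ → Carrier
  qbinom q l k = if l <ᵇ k then 0# else (qfact q l / (qfact q k * qfact q (l ∸ k)))

  weight : Carrier → Carrier → ℤ → Carrier
  weight a q k =
    ((1# - a * (q ^ᶻ ((+ 2) ℤ.* k ℤ.+ (+ 1)))) / (1# - a * (q ^ᶻ ((+ 2) ℤ.* k ℤ.- (+ 1))))) * (q ⁻¹)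

-- Columns are i ∈ Fin l (column number toℕ i + 1), rows j ∈ Fin m
-- (row number toℕ j + 1, counted from the bottom).  A placement with at most one rook per column is a vector
-- P : Vec (Maybe (Fin m)) l, P[i] = just j meaning a rook on cell (i,j).

Placement : ℕ → ℕ → Set
Placement l m = Vec (Maybe (Fin m)) l

allPlacements : (l m : ℕ) → List (Placement l m)
allPlacements zero m = [] ∷ []
allPlacements (suc l) m =
  concatMap (λ P → map (λ o → o ∷ P) (nothing ∷ map just (allFin m))) (allPlacements l m)

rooks : ∀ {l m} → Placement l m → List (Fin m)
rooks [] = []
rooks (nothing ∷ P) = rooks P
rooks (just j ∷ P) = j ∷ rooks P

eqFin : ∀ {m} → Fin m → Fin m → Bool
eqFin i j = does (i Fin.≟ j)

distinctᵇ : ∀ {m} → List (Fin m) → Bool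
distinctᵇ [] = true
distinctᵇ (j ∷ js) = not (any (eqFin j) js) ∧ distinctᵇ js

isNk : ∀ {l m} → ℕ → Placement l m → Bool
isNk k P = does (length (rooks P) ℕ.≟ k) ∧ distinctᵇ (rooks P)

Nk : (l m k : ℕ) → List (Placement l m)
Nk l m k = filter (λ P → isNk k P ≟ᵇ true) (allPlacements l m)

cells : (l m : ℕ) → List (Fin l × Fin m)
cells l m = concatMap (λ i → map (λ j → (i , j)) (allFin m)) (allFin l)

rookAt : ∀ {l m} → Placement l m → Fin l → Fin m → Bool
rookAt P i j with lookup P i
... | nothing = false
... | just j' = eqFin j j'

cancelled : ∀ {l m} → Placement l m → Fin l → Fin m → Bool
cancelled {l} P i j =
  any (λ i' → (toℕ i' <ᵇ toℕ i) ∧ rookAt P i' j) (allFin l)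
  ∨ caseJ (lookup P i)
  where
    caseJ : ∀ {m} → Maybe (Fin m) → Bool
    caseJ nothing = false
    caseJ (just j') = toℕ j <ᵇ toℕ j'

inU : ∀ {l m} → Placement l m → Fin l → Fin m → Bool
inU P i j = not (rookAt P i j) ∧ not (cancelled P i j)

rcount : ∀ {l m} → Placement l m → Fin l → Fin m → ℕ
rcount {l} {m} P i j =
  length (filter (λ c → (toℕ (proj₁ c) <ᵇ toℕ i) ∧ (toℕ j <ᵇ toℕ (proj₂ c)) ∧ rookAt P (proj₁ c) (proj₂ c) ≟ᵇ true)
                 (cells l m))

module Rook {c ℓ} (K : Field c ℓ) where
  open Field K
  open FieldOps K

  placementWeight : ∀ {l m} → Carrier → Carrier → Placement l m → Carrier
  placementWeight {l} {m} a q P =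
    prodL (map (λ c → weight a q (((+ toℕ (proj₁ c)) ℤ.- (+ toℕ (proj₂ c))) ℤ.- (+ rcount P (proj₁ c) (proj₂ c))))
               (filter (λ c → inU P (proj₁ c) (proj₂ c) ≟ᵇ true) (cells l m)))

  rookNumber : Carrier → Carrier → (l m k : ℕ) → Carrier
  rookNumber a q l m k = sumL (map (placementWeight a q) (Nk l m k))

-- Put m = k + d and x = a q^(1-2m).  Expand the sum over placements along the
-- first column, for the more general rook numbers of the last l columns of a
-- board whose first c columns hold rooks in a set D of rows.  The free cells of
-- a column carry the weights ω(x q^(2t)), t = 0, 1, …, whose product telescopes:
-- the first s of them multiply to (1 - x q^(2s)) / (q^s (1 - x)).  A column
-- without rook contributes all of them; a rook in the free row with s free rows
-- above it contributes the first s, and summing over its b = 0, 1, … free rows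
-- below is a geometric sum.  Hence, scaled by q^(l m) (x; q²)_m, the rook
-- numbers obey the q-Pascal recursion in l of
--   q^(1+2+…+k) [l choose k]_q [m]!/[d]! (x q^(l+d-1); q)_k (x q^(2l); q²)_d,
-- which is the stated formula once the q-binomial is written with factorials.

module Submission where

open import Algebra.Bundles using (CommutativeRing)
open import Defs
open import Data.Nat as ℕ using (ℕ; zero; suc; _≤_; _∸_; _<ᵇ_)
import Data.Nat.Properties as ℕP
import Data.Nat.Solver
open import Data.Nat.Combinatorics using (_C_; nC1≡n; nCk+nC[k+1]≡[n+1]C[k+1])
open import Data.Integer as ℤ using (ℤ; +_; -[1+_])
import Data.Integer.Properties as ℤP
import Data.Integer.Solver
open import Data.Bool using (Bool; true; false; if_then_else_; _∧_; _∨_; not)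
open import Data.Maybe using (Maybe; just; nothing)
open import Data.Fin as Fin using (Fin; toℕ)
open import Data.Product using (Σ; _,_; proj₁; proj₂)
open import Function using (_∘_; id)
open import Relation.Nullary using (¬_; does; yes; no)
import Relation.Binary.PropositionalEquality as ≡

module IntegerCoefficients {c ℓ} (R : CommutativeRing c ℓ) where
  open import Algebra.Solver.Ring.AlmostCommutativeRing using (_-Raw-AlmostCommutative⟶_; fromCommutativeRing)
  open import Data.Sign as Sign using (Sign)

  open CommutativeRing R
  open import Algebra.Properties.Ring ring using (-‿+-comm; -0#≈0#; -‿involutive; -‿distribˡ-*)
  open import Algebra.Properties.Semiring.Mult.TCOptimised semiring using (_×_; 1+×; ×-homo-+; ×1-homo-*)
  open import Relation.Binary.Reasoning.Setoid setoid

  private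
    -- The optimised _×_ has 1 × 1# = 1#, so the solver's constants 0 and 1 are
    -- definitionally 0# and 1#, as hypotheses fed to ≈-modulo require.
    fromℕ : ℕ → Carrier
    fromℕ n = n × 1#

    fromℤ : ℤ → Carrier
    fromℤ (+ n) = fromℕ n
    fromℤ -[1+ n ] = - fromℕ (suc n)

    1+x-1+y≈x-y : ∀ x y → (1# + x) - (1# + y) ≈ x - y
    1+x-1+y≈x-y x y = begin
      (1# + x) + - (1# + y)   ≈⟨ +-congˡ (-‿+-comm 1# y) ⟨
      (1# + x) + (- 1# + - y) ≈⟨ +-assoc 1# x _ ⟩
      1# + (x + (- 1# + - y)) ≈⟨ +-congˡ (+-comm x _) ⟩
      1# + ((- 1# + - y) + x) ≈⟨ +-congˡ (+-assoc (- 1#) _ x) ⟩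
      1# + (- 1# + (- y + x)) ≈⟨ +-assoc 1# (- 1#) _ ⟨
      (1# + - 1#) + (- y + x) ≈⟨ +-cong (-‿inverseʳ 1#) (+-comm (- y) x) ⟩
      0# + (x - y)            ≈⟨ +-identityˡ _ ⟩
      x - y                   ∎

    fromℤ-⊖ : ∀ m n → fromℤ (m ℤ.⊖ n) ≈ fromℕ m - fromℕ n
    fromℤ-⊖ zero    zero    = sym (-‿inverseʳ 0#)
    fromℤ-⊖ (suc m) zero    = sym (trans (+-congˡ -0#≈0#) (+-identityʳ _))
    fromℤ-⊖ zero    (suc n) = sym (+-identityˡ _)
    fromℤ-⊖ (suc m) (suc n) = begin
      fromℤ (suc m ℤ.⊖ suc n) ≡⟨ ≡.cong fromℤ (ℤP.[1+m]⊖[1+n]≡m⊖n m n) ⟩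
      fromℤ (m ℤ.⊖ n)         ≈⟨ fromℤ-⊖ m n ⟩
      fromℕ m - fromℕ n       ≈⟨ 1+x-1+y≈x-y _ _ ⟨
      (1# + fromℕ m) - (1# + fromℕ n) ≈⟨ +-cong (1+× m 1#) (-‿cong (1+× n 1#)) ⟨
      fromℕ (suc m) - fromℕ (suc n) ∎

    fromℤ-+ : ∀ i j → fromℤ (i ℤ.+ j) ≈ fromℤ i + fromℤ j
    fromℤ-+ (+ m)    (+ n)    = ×-homo-+ 1# m n
    fromℤ-+ (+ m)    -[1+ n ] = fromℤ-⊖ m (suc n)
    fromℤ-+ -[1+ m ] (+ n)    = trans (fromℤ-⊖ n (suc m)) (+-comm _ _)
    fromℤ-+ -[1+ m ] -[1+ n ] = begin
      - fromℕ (suc (suc (m ℕ.+ n)))     ≡⟨ ≡.cong (λ k → - fromℕ (suc k)) (ℕP.+-suc m n) ⟨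
      - fromℕ (suc m ℕ.+ suc n)         ≈⟨ -‿cong (×-homo-+ 1# (suc m) (suc n)) ⟩
      - (fromℕ (suc m) + fromℕ (suc n)) ≈⟨ -‿+-comm _ _ ⟨
      - fromℕ (suc m) + - fromℕ (suc n) ∎

    fromSign : Sign → Carrier
    fromSign Sign.+ = 1#
    fromSign Sign.- = - 1#

    fromℤ-◃ : ∀ s n → fromℤ (s ℤ.◃ n) ≈ fromSign s * fromℕ n
    fromℤ-◃ s       zero    = sym (zeroʳ _)
    fromℤ-◃ Sign.+ (suc n) = sym (*-identityˡ _)
    fromℤ-◃ Sign.- (suc n) = trans (-‿cong (sym (*-identityˡ _))) (-‿distribˡ-* _ _)

    fromSign-* : ∀ s t → fromSign (s Sign.* t) ≈ fromSign s * fromSign t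
    fromSign-* Sign.+ t      = sym (*-identityˡ _)
    fromSign-* Sign.- Sign.+ = sym (*-identityʳ _)
    fromSign-* Sign.- Sign.- = sym (begin
      - 1# * - 1#   ≈⟨ -‿distribˡ-* 1# (- 1#) ⟨
      - (1# * - 1#) ≈⟨ -‿cong (*-identityˡ _) ⟩
      - - 1#        ≈⟨ -‿involutive 1# ⟩
      1#            ∎)

    fromℤ-signAbs : ∀ i → fromℤ i ≈ fromSign (ℤ.sign i) * fromℕ ℤ.∣ i ∣
    fromℤ-signAbs i = trans (reflexive (≡.cong fromℤ (≡.sym (ℤP.◃-inverse i)))) (fromℤ-◃ (ℤ.sign i) ℤ.∣ i ∣)

    fromℤ-* : ∀ i j → fromℤ (i ℤ.* j) ≈ fromℤ i * fromℤ j
    fromℤ-* i j = begin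
      fromℤ (i ℤ.* j)                          ≈⟨ fromℤ-◃ (s Sign.* t) (∣i∣ ℕ.* ∣j∣) ⟩
      fromSign (s Sign.* t) * fromℕ (∣i∣ ℕ.* ∣j∣) ≈⟨ *-cong (fromSign-* s t) (×1-homo-* ∣i∣ ∣j∣) ⟩
      (fromSign s * fromSign t) * (fromℕ ∣i∣ * fromℕ ∣j∣) ≈⟨ interchange _ _ _ _ ⟩
      (fromSign s * fromℕ ∣i∣) * (fromSign t * fromℕ ∣j∣) ≈⟨ *-cong (fromℤ-signAbs i) (fromℤ-signAbs j) ⟨
      fromℤ i * fromℤ j                        ∎
      where
      s = ℤ.sign i
      t = ℤ.sign j
      ∣i∣ = ℤ.∣ i ∣
      ∣j∣ = ℤ.∣ j ∣
      interchange : ∀ w x y z → (w * x) * (y * z) ≈ (w * y) * (x * z)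
      interchange w x y z = begin
        (w * x) * (y * z) ≈⟨ *-assoc w x _ ⟩
        w * (x * (y * z)) ≈⟨ *-congˡ (*-assoc x y z) ⟨
        w * ((x * y) * z) ≈⟨ *-congˡ (*-congʳ (*-comm x y)) ⟩
        w * ((y * x) * z) ≈⟨ *-congˡ (*-assoc y x z) ⟩
        w * (y * (x * z)) ≈⟨ *-assoc w y _ ⟨
        (w * y) * (x * z) ∎

    fromℤ-neg : ∀ i → fromℤ (ℤ.- i) ≈ - fromℤ i
    fromℤ-neg (+ zero)  = sym -0#≈0#
    fromℤ-neg (+ suc n) = refl
    fromℤ-neg -[1+ n ]  = sym (-‿involutive _)

    fromℤ-homomorphism : ℤ.+-*-rawRing -Raw-AlmostCommutative⟶ fromCommutativeRing R
    fromℤ-homomorphism = record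
      { ⟦_⟧ = fromℤ ; +-homo = fromℤ-+ ; *-homo = fromℤ-* ; -‿homo = fromℤ-neg
      ; 0-homo = refl ; 1-homo = refl }

    fromℤ-≟ : ∀ i j → Maybe (fromℤ i ≈ fromℤ j)
    fromℤ-≟ i j with i ℤP.≟ j
    ... | yes ≡.refl = just refl
    ... | no _ = nothing

    difference-≈-0 : ∀ {x y} → x ≈ y → x - y ≈ 0#
    difference-≈-0 {x} {y} x≈y = trans (+-congʳ x≈y) (-‿inverseʳ y)

  open import Algebra.Solver.Ring ℤ.+-*-rawRing (fromCommutativeRing R) fromℤ-homomorphism fromℤ-≟ public
    using (solve; _:=_; _:+_; _:-_; _:*_; :-_; con)

  -- An identity of the form  x ≈ y + Σ cᵢ (uᵢ - vᵢ)  is a polynomial identity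
  -- the solver can check; together with the hypotheses uᵢ ≈ vᵢ it gives x ≈ y.
  ≈-modulo₁ : ∀ {x y c₁ u₁ v₁} → x ≈ y + c₁ * (u₁ - v₁) → u₁ ≈ v₁ → x ≈ y
  ≈-modulo₁ e h = trans e (trans (+-congˡ (trans (*-congˡ (difference-≈-0 h)) (zeroʳ _))) (+-identityʳ _))

  ≈-modulo₂ : ∀ {x y c₁ u₁ v₁ c₂ u₂ v₂} → x ≈ y + c₁ * (u₁ - v₁) + c₂ * (u₂ - v₂) →
              u₁ ≈ v₁ → u₂ ≈ v₂ → x ≈ y
  ≈-modulo₂ e h₁ h₂ = ≈-modulo₁ (≈-modulo₁ e h₂) h₁

  ≈-modulo₃ : ∀ {x y c₁ u₁ v₁ c₂ u₂ v₂ c₃ u₃ v₃} →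
              x ≈ y + c₁ * (u₁ - v₁) + c₂ * (u₂ - v₂) + c₃ * (u₃ - v₃) →
              u₁ ≈ v₁ → u₂ ≈ v₂ → u₃ ≈ v₃ → x ≈ y
  ≈-modulo₃ e h₁ h₂ h₃ = ≈-modulo₂ (≈-modulo₁ e h₃) h₁ h₂

  ≈-modulo₄ : ∀ {x y c₁ u₁ v₁ c₂ u₂ v₂ c₃ u₃ v₃ c₄ u₄ v₄} →
              x ≈ y + c₁ * (u₁ - v₁) + c₂ * (u₂ - v₂) + c₃ * (u₃ - v₃) + c₄ * (u₄ - v₄) →
              u₁ ≈ v₁ → u₂ ≈ v₂ → u₃ ≈ v₃ → u₄ ≈ v₄ → x ≈ y
  ≈-modulo₄ e h₁ h₂ h₃ h₄ = ≈-modulo₃ (≈-modulo₁ e h₄) h₁ h₂ h₃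

module FieldFacts {c ℓ} (K : Field c ℓ) where

  open Field K hiding (zero)
  open FieldOps K
  open IntegerCoefficients commutativeRing
  open import Relation.Binary.Reasoning.Setoid setoid

  ⁻¹-inverseˡ : ∀ x → ¬ (x ≈ 0#) → x ⁻¹ * x ≈ 1#
  ⁻¹-inverseˡ x x≉0 = trans (*-comm _ _) (⁻¹-inverseʳ x x≉0)

  *-cancelˡ-≉0 : ∀ {z x y} → ¬ (z ≈ 0#) → z * x ≈ z * y → x ≈ y
  *-cancelˡ-≉0 {z} {x} {y} z≉0 e = begin
    x              ≈⟨ *-identityˡ x ⟨
    1# * x         ≈⟨ *-congʳ (⁻¹-inverseˡ z z≉0) ⟨
    (z ⁻¹ * z) * x ≈⟨ *-assoc _ _ _ ⟩
    z ⁻¹ * (z * x) ≈⟨ *-congˡ e ⟩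
    z ⁻¹ * (z * y) ≈⟨ *-assoc _ _ _ ⟨
    (z ⁻¹ * z) * y ≈⟨ *-congʳ (⁻¹-inverseˡ z z≉0) ⟩
    1# * y         ≈⟨ *-identityˡ y ⟩
    y              ∎

  *-cancelʳ-≉0 : ∀ {z x y} → ¬ (z ≈ 0#) → x * z ≈ y * z → x ≈ y
  *-cancelʳ-≉0 z≉0 e = *-cancelˡ-≉0 z≉0 (trans (*-comm _ _) (trans e (*-comm _ _)))

  *-≉0 : ∀ {x y} → ¬ (x ≈ 0#) → ¬ (y ≈ 0#) → ¬ (x * y ≈ 0#)
  *-≉0 {x} {y} x≉0 y≉0 xy≈0 = y≉0 (*-cancelˡ-≉0 x≉0 (trans xy≈0 (sym (zeroʳ x))))

  1-x≉0 : ∀ {x} → ¬ (x ≈ 1#) → ¬ (1# - x ≈ 0#)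
  1-x≉0 {x} x≉1 1-x≈0 = x≉1 (≈-modulo₁
    (solve 1 (λ X → X := con (+ 1) :+ (:- con (+ 1)) :* ((con (+ 1) :- X) :- con (+ 0))) refl x) 1-x≈0)

  ^-+ : ∀ x m n → x ^ (m ℕ.+ n) ≈ x ^ m * x ^ n
  ^-+ x zero    n = sym (*-identityˡ _)
  ^-+ x (suc m) n = trans (*-congˡ (^-+ x m n)) (sym (*-assoc _ _ _))

  ^-distrib-* : ∀ x y n → (x * y) ^ n ≈ x ^ n * y ^ n
  ^-distrib-* x y zero    = sym (*-identityˡ _)
  ^-distrib-* x y (suc n) = trans (*-congˡ (^-distrib-* x y n))
    (solve 4 (λ X Y U V → (X :* Y) :* (U :* V) := (X :* U) :* (Y :* V)) refl x y (x ^ n) (y ^ n))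

  ^-≉0 : ∀ {x} → ¬ (x ≈ 0#) → ∀ n → ¬ (x ^ n ≈ 0#)
  ^-≉0 x≉0 zero    1≈0 = 0≉1 (sym 1≈0)
  ^-≉0 x≉0 (suc n)     = *-≉0 x≉0 (^-≉0 x≉0 n)

  ^ᶻ-suc : ∀ {x} → ¬ (x ≈ 0#) → ∀ u → x ^ᶻ (u ℤ.+ + 1) ≈ x ^ᶻ u * x
  ^ᶻ-suc {x} x≉0 (+ n)         = trans (^-+ x n 1) (*-congˡ (*-identityʳ x))
  ^ᶻ-suc {x} x≉0 -[1+ 0 ]      = sym (trans (*-congʳ (*-identityʳ _)) (⁻¹-inverseˡ x x≉0))
  ^ᶻ-suc {x} x≉0 -[1+ suc k ]  = ≈-modulo₁
    (solve 3 (λ Y I X → Y := (I :* Y) :* X :+ (:- Y) :* (X :* I :- con (+ 1))) refl ((x ⁻¹) ^ suc k) (x ⁻¹) x)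
    (⁻¹-inverseʳ x x≉0)

  ^ᶻ-+ : ∀ {x} → ¬ (x ≈ 0#) → ∀ u n → x ^ᶻ (u ℤ.+ + n) ≈ x ^ᶻ u * x ^ n
  ^ᶻ-+ {x} x≉0 u zero    = trans (reflexive (≡.cong (x ^ᶻ_) (ℤP.+-identityʳ u))) (sym (*-identityʳ _))
  ^ᶻ-+ {x} x≉0 u (suc n) = begin
    x ^ᶻ (u ℤ.+ + suc n)       ≡⟨ ≡.cong (x ^ᶻ_) (ℤP.+-assoc u (+ 1) (+ n)) ⟨
    x ^ᶻ ((u ℤ.+ + 1) ℤ.+ + n) ≈⟨ ^ᶻ-+ x≉0 (u ℤ.+ + 1) n ⟩
    x ^ᶻ (u ℤ.+ + 1) * x ^ n   ≈⟨ *-congʳ (^ᶻ-suc x≉0 u) ⟩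
    (x ^ᶻ u * x) * x ^ n       ≈⟨ *-assoc _ _ _ ⟩
    x ^ᶻ u * (x * x ^ n)       ∎

  poch-cong : ∀ {x y} b n → x ≈ y → poch x b n ≈ poch y b n
  poch-cong b zero    e = refl
  poch-cong b (suc n) e = *-cong (poch-cong b n e) (+-congˡ (-‿cong (*-congʳ e)))

  poch-unfoldˡ : ∀ x b n → poch x b (suc n) ≈ (1# - x) * poch (x * b) b n
  poch-unfoldˡ x b zero = solve 1 (λ X → con (+ 1) :* (con (+ 1) :- X :* con (+ 1)) := (con (+ 1) :- X) :* con (+ 1)) refl x
  poch-unfoldˡ x b (suc n) = begin
    poch x b (suc n) * (1# - x * (b * b ^ n))                 ≈⟨ *-congʳ (poch-unfoldˡ x b n) ⟩
    ((1# - x) * poch (x * b) b n) * (1# - x * (b * b ^ n))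
      ≈⟨ solve 4 (λ X B W Bn → ((con (+ 1) :- X) :* W) :* (con (+ 1) :- X :* (B :* Bn))
                   := (con (+ 1) :- X) :* (W :* (con (+ 1) :- (X :* B) :* Bn))) refl x b (poch (x * b) b n) (b ^ n) ⟩
    (1# - x) * (poch (x * b) b n * (1# - (x * b) * b ^ n))    ∎

  poch-≉0 : ∀ {x b} → (∀ s → ¬ (1# - x * b ^ s ≈ 0#)) → ∀ n → ¬ (poch x b n ≈ 0#)
  poch-≉0 factor≉0 zero    1≈0 = 0≉1 (sym 1≈0)
  poch-≉0 factor≉0 (suc n)     = *-≉0 (poch-≉0 factor≉0 n) (factor≉0 n)

module QCalculus {c ℓ} (K : Field c ℓ) (q : Field.Carrier K) where

  open Field K hiding (zero)
  open FieldOps K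
  open IntegerCoefficients commutativeRing
  open FieldFacts K
  open import Relation.Binary.Reasoning.Setoid setoid
  open Data.Nat.Solver.+-*-Solver using () renaming (solve to solveℕ; _:=_ to _:=ℕ_; _:+_ to _:+ℕ_; con to conℕ)

  q² : Carrier
  q² = q * q

  qnum : ℕ → Carrier
  qnum zero    = 0#
  qnum (suc n) = 1# + q * qnum n

  qnum-suc : ∀ n → 1# + q * qnum n ≈ qnum n + q ^ n
  qnum-suc zero    = solve 1 (λ Q → con (+ 1) :+ Q :* con (+ 0) := con (+ 0) :+ con (+ 1)) refl q
  qnum-suc (suc n) = ≈-modulo₁ (solve 3 (λ Q N Qn → con (+ 1) :+ Q :* (con (+ 1) :+ Q :* N)
       := (con (+ 1) :+ Q :* N) :+ Q :* Qn :+ Q :* (con (+ 1) :+ Q :* N :- (N :+ Qn))) refl q (qnum n) (q ^ n))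
    (qnum-suc n)

  qnum-*1-q : ∀ n → qnum n * (1# - q) ≈ 1# - q ^ n
  qnum-*1-q zero    = solve 1 (λ Q → con (+ 0) :* (con (+ 1) :- Q) := con (+ 1) :- con (+ 1)) refl q
  qnum-*1-q (suc n) = ≈-modulo₁ (solve 3 (λ Q N Qn → (con (+ 1) :+ Q :* N) :* (con (+ 1) :- Q) := con (+ 1) :- Q :* Qn
                        :+ Q :* (N :* (con (+ 1) :- Q) :- (con (+ 1) :- Qn))) refl q (qnum n) (q ^ n)) (qnum-*1-q n)

  qfactorial : ℕ → Carrier
  qfactorial zero    = 1#
  qfactorial (suc n) = qnum (suc n) * qfactorial n

  -- [k+d]! / [d]!
  qfalling : ℕ → ℕ → Carrier
  qfalling zero    d = 1#
  qfalling (suc k) d = qnum (suc (k ℕ.+ d)) * qfalling k d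

  qfactorial-+ : ∀ k d → qfactorial (k ℕ.+ d) ≈ qfalling k d * qfactorial d
  qfactorial-+ zero    d = sym (*-identityˡ _)
  qfactorial-+ (suc k) d = trans (*-congˡ (qfactorial-+ k d)) (sym (*-assoc _ _ _))

  gauss : ℕ → ℕ → Carrier
  gauss zero    zero    = 1#
  gauss zero    (suc k) = 0#
  gauss (suc l) zero    = 1#
  gauss (suc l) (suc k) = gauss l k + q ^ suc k * gauss l (suc k)

  gauss-l0 : ∀ l → gauss l 0 ≈ 1#
  gauss-l0 zero    = refl
  gauss-l0 (suc l) = refl

  gauss-absorption : ∀ l k → q ^ suc k * (1# - q ^ suc k) * gauss l (suc k) ≈ (q ^ suc k - q ^ suc l) * gauss l k
  gauss-absorption zero zero = solve 1 (λ Q → Q :* con (+ 1) :* (con (+ 1) :- Q :* con (+ 1)) :* con (+ 0)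
                                            := (Q :* con (+ 1) :- Q :* con (+ 1)) :* con (+ 1)) refl q
  gauss-absorption zero (suc k) = solve 2 (λ Q A → Q :* A :* (con (+ 1) :- Q :* A) :* con (+ 0)
                                               := (Q :* A :- Q :* con (+ 1)) :* con (+ 0)) refl q (q ^ suc k)
  gauss-absorption (suc l) zero = ≈-modulo₂ (solve 4 (λ Q B G0 G1 →
        Q :* con (+ 1) :* (con (+ 1) :- Q :* con (+ 1)) :* (G0 :+ Q :* con (+ 1) :* G1)
     := (Q :* con (+ 1) :- Q :* B) :* con (+ 1)
        :+ (Q :* con (+ 1)) :* (Q :* con (+ 1) :* (con (+ 1) :- Q :* con (+ 1)) :* G1 :- (Q :* con (+ 1) :- B) :* G0)
        :+ (Q :* con (+ 1) :- Q :* B) :* (G0 :- con (+ 1))) refl q (q ^ suc l) (gauss l 0) (gauss l 1))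
    (gauss-absorption l zero) (gauss-l0 l)
  gauss-absorption (suc l) (suc k) = ≈-modulo₂ (solve 6 (λ Q A B G0 G1 G2 →
        Q :* A :* (con (+ 1) :- Q :* A) :* (G1 :+ Q :* A :* G2)
     := (Q :* A :- Q :* B) :* (G0 :+ A :* G1)
        :+ (Q :* A) :* (Q :* A :* (con (+ 1) :- Q :* A) :* G2 :- (Q :* A :- B) :* G1)
        :+ Q :* (A :* (con (+ 1) :- A) :* G1 :- (A :- B) :* G0))
      refl q (q ^ suc k) (q ^ suc l) (gauss l k) (gauss l (suc k)) (gauss l (suc (suc k))))
    (gauss-absorption l (suc k)) (gauss-absorption l k)

  -- The second Pascal rule G(l+1,k+1) = q^(l-k) G(l,k) + G(l,k+1), multiplied through by q^(k+1).
  gauss-pascal′ : ∀ l k → q ^ suc k * gauss (suc l) (suc k) ≈ q ^ suc k * gauss l (suc k) + q ^ suc l * gauss l k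
  gauss-pascal′ l k = ≈-modulo₁ (solve 4 (λ A B G0 G1 →
        A :* (G0 :+ A :* G1) := A :* G1 :+ B :* G0 :+ (:- con (+ 1)) :* (A :* (con (+ 1) :- A) :* G1 :- (A :- B) :* G0))
     refl (q ^ suc k) (q ^ suc l) (gauss l k) (gauss l (suc k))) (gauss-absorption l k)

  gauss-<ᵇ : ∀ l k → (l <ᵇ k) ≡.≡ true → gauss l k ≈ 0#
  gauss-<ᵇ zero    (suc k) l<k = refl
  gauss-<ᵇ (suc l) (suc k) l<k = begin
    gauss l k + q ^ suc k * gauss l (suc k) ≈⟨ +-cong (gauss-<ᵇ l k l<k) (*-congˡ (gauss-<ᵇ l (suc k) (<ᵇ-suc l k l<k))) ⟩
    0# + q ^ suc k * 0#                     ≈⟨ trans (+-identityˡ _) (zeroʳ _) ⟩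
    0#                                      ∎
    where
    <ᵇ-suc : ∀ l k → (l <ᵇ k) ≡.≡ true → (l <ᵇ suc k) ≡.≡ true
    <ᵇ-suc zero    k       _   = ≡.refl
    <ᵇ-suc (suc l) (suc k) l<k = <ᵇ-suc l k l<k

  triangular : ℕ → ℕ
  triangular zero    = 0
  triangular (suc k) = suc k ℕ.+ triangular k

  triangular≡C2 : ∀ k → triangular k ≡.≡ suc k C 2
  triangular≡C2 zero    = ≡.refl
  triangular≡C2 (suc k) = ≡.trans (≡.cong₂ ℕ._+_ (≡.sym (nC1≡n (suc k))) (triangular≡C2 k)) (nCk+nC[k+1]≡[n+1]C[k+1] (suc k) 1)

  -- The rescaled rook number (see ClosedFormAt).  The truncated (l + d) ∸ 1 is
  -- harmless: for l + d = 0 and k > 0 the Gaussian coefficient vanishes.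
  closedForm : Carrier → ℕ → ℕ → ℕ → Carrier
  closedForm x d l k =
    q ^ triangular k * gauss l k * qfalling k d * poch (x * q ^ ((l ℕ.+ d) ∸ 1)) q k * poch (x * q² ^ l) q² d

  closedForm-suc-0 : ∀ x d l → closedForm x d (suc l) 0 ≈ closedForm (x * q²) d l 0
  closedForm-suc-0 x d l = *-cong (*-congʳ (*-congʳ (*-congˡ (sym (gauss-l0 l))))) (poch-cong q² d (sym (*-assoc _ _ _)))

  closedForm-suc-suc : ∀ x d l k → closedForm x d (suc l) (suc k) ≈
    closedForm (x * q²) d l (suc k) + (q ^ suc l * qnum (suc (k ℕ.+ d)) * (1# - x * q ^ (k ℕ.+ d))) * closedForm (x * q²) d l k
  closedForm-suc-suc x d zero zero = begin
    closedForm x d 1 1 ≈⟨ *-congˡ (poch-cong q² d (sym (*-assoc _ _ _))) ⟩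
    q ^ 1 * gauss 1 1 * qfalling 1 d * poch (x * q ^ d) q 1 * Z
      ≈⟨ solve 6 (λ Q N X Xd Zz W →
           Q :* con (+ 1) :* (con (+ 1) :+ Q :* con (+ 1) :* con (+ 0)) :* (N :* con (+ 1))
             :* (con (+ 1) :* (con (+ 1) :- X :* Xd :* con (+ 1))) :* Zz
           := Q :* con (+ 1) :* con (+ 0) :* (N :* con (+ 1)) :* W :* Zz
              :+ (Q :* con (+ 1) :* N :* (con (+ 1) :- X :* Xd)) :* (con (+ 1) :* con (+ 1) :* con (+ 1) :* con (+ 1) :* Zz))
           refl q (qnum (suc d)) x (q ^ d) Z _ ⟩
    closedForm (x * q²) d 0 1 + (q ^ 1 * qnum (suc d) * (1# - x * q ^ d)) * closedForm (x * q²) d 0 0 ∎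
    where Z = poch ((x * q²) * (q² ^ 0)) q² d
  closedForm-suc-suc x d zero (suc k) = solve 14 (λ T A F P Z T' F' P' Z' C T'' F'' P'' Z'' →
      T :* (con (+ 0) :+ A :* con (+ 0)) :* F :* P :* Z
      := T' :* con (+ 0) :* F' :* P' :* Z' :+ C :* (T'' :* con (+ 0) :* F'' :* P'' :* Z'')) refl _ _ _ _ _ _ _ _ _ _ _ _ _ _
  closedForm-suc-suc x d (suc l) k = begin
    closedForm x d (suc (suc l)) (suc k)
      ≈⟨ *-cong (*-cong (*-congʳ (*-congʳ (^-+ q (suc k) (triangular k)))) (poch-unfoldˡ _ q k)) (poch-cong q² d (sym (*-assoc x q² _))) ⟩
    (q ^ suc k * q ^ triangular k) * (g₀ + q ^ suc k * g₁) * (N * Fk) * ((1# - x * (q * U)) * W) * Z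
      ≈⟨ ≈-modulo₂ (solve 13 (λ X Q Qk Tk G0 G1 Nn Fkk U W Zz Bsl Ee →
            (Q :* Qk :* Tk) :* (G0 :+ Q :* Qk :* G1) :* (Nn :* Fkk) :* ((con (+ 1) :- X :* (Q :* U)) :* W) :* Zz
            := (Q :* Qk :* Tk) :* G1 :* (Nn :* Fkk) :* (W :* (con (+ 1) :- (X :* (Q :* U) :* Q) :* Qk)) :* Zz
               :+ (Q :* Bsl :* Nn :* (con (+ 1) :- X :* Ee)) :* (Tk :* G0 :* Fkk :* W :* Zz)
               :+ (Tk :* Nn :* Fkk :* W :* Zz) :* ((Q :* Qk) :* (G0 :+ (Q :* Qk) :* G1) :- ((Q :* Qk) :* G1 :+ (Q :* Bsl) :* G0))
               :+ (:- (Tk :* Nn :* Fkk :* W :* Zz :* X :* G0)) :* ((Q :* U) :* (Q :* Qk) :- (Q :* Bsl) :* Ee))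
            refl x q (q ^ k) (q ^ triangular k) g₀ g₁ N Fk U W Z (q ^ suc l) E)
          (gauss-pascal′ (suc l) k) exponents ⟩
    (q ^ suc k * q ^ triangular k) * g₁ * (N * Fk) * (W * (1# - ((x * (q * U)) * q) * q ^ k)) * Z
      + (q ^ suc (suc l) * N * (1# - x * q ^ (k ℕ.+ d))) * (q ^ triangular k * g₀ * Fk * W * Z)
      ≈⟨ +-cong (*-cong (*-cong (*-congʳ (*-congʳ (^-+ q (suc k) (triangular k)))) (poch-cong q (suc k) shift)) refl)
                (*-congˡ (*-congʳ (*-congˡ (poch-cong q k shift)))) ⟨
    closedForm (x * q²) d (suc l) (suc k)
      + (q ^ suc (suc l) * qnum (suc (k ℕ.+ d)) * (1# - x * q ^ (k ℕ.+ d))) * closedForm (x * q²) d (suc l) k ∎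
    where
    g₀ = gauss (suc l) k
    g₁ = gauss (suc l) (suc k)
    N = qnum (suc (k ℕ.+ d))
    Fk = qfalling k d
    U = q ^ (l ℕ.+ d)
    W = poch ((x * (q * U)) * q) q k
    Z = poch ((x * q²) * q² ^ suc l) q² d
    E = q ^ (k ℕ.+ d)
    shift : (x * q²) * q ^ (l ℕ.+ d) ≈ (x * (q * U)) * q
    shift = solve 3 (λ X Q U → (X :* (Q :* Q)) :* U := (X :* (Q :* U)) :* Q) refl x q U
    exponents : (q * U) * (q * q ^ k) ≈ (q * q ^ suc l) * E
    exponents = begin
      q ^ suc (l ℕ.+ d) * q ^ suc k   ≈⟨ ^-+ q (suc (l ℕ.+ d)) (suc k) ⟨
      q ^ (suc (l ℕ.+ d) ℕ.+ suc k)   ≡⟨ ≡.cong (q ^_) (solveℕ 3 (λ a b c → conℕ 1 :+ℕ (a :+ℕ b) :+ℕ (conℕ 1 :+ℕ c)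
                                            :=ℕ conℕ 2 :+ℕ a :+ℕ (c :+ℕ b)) ≡.refl l d k) ⟩
      q ^ (suc (suc l) ℕ.+ (k ℕ.+ d)) ≈⟨ ^-+ q (suc (suc l)) (k ℕ.+ d) ⟩
      q ^ suc (suc l) * E             ∎

  -- Σ_{s+b=n-1} h s b
  antidiagonalSum : ℕ → (ℕ → ℕ → Carrier) → Carrier
  antidiagonalSum zero    h = 0#
  antidiagonalSum (suc n) h = h n 0 + antidiagonalSum n (λ s b → h s (suc b))

  antidiagonalSum-cong : ∀ n {h h′} → (∀ s b → h s b ≈ h′ s b) → antidiagonalSum n h ≈ antidiagonalSum n h′
  antidiagonalSum-cong zero    e = refl
  antidiagonalSum-cong (suc n) e = +-cong (e n 0) (antidiagonalSum-cong n (λ s b → e s (suc b)))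

  antidiagonalSum-*ˡ : ∀ n x h → antidiagonalSum n (λ s b → x * h s b) ≈ x * antidiagonalSum n h
  antidiagonalSum-*ˡ zero    x h = sym (zeroʳ x)
  antidiagonalSum-*ˡ (suc n) x h = trans (+-congˡ (antidiagonalSum-*ˡ n x (λ s b → h s (suc b)))) (sym (distribˡ x _ _))

  antidiagonalSum-geometric : ∀ n x L →
    antidiagonalSum n (λ s b → (1# - x * q² ^ s) * q ^ (b ℕ.+ L)) * q ≈ q ^ L * qnum n * (q - x * q ^ n)
  antidiagonalSum-geometric zero x L =
    solve 3 (λ X Q QL → con (+ 0) :* Q := QL :* con (+ 0) :* (Q :- X :* con (+ 1))) refl x q (q ^ L)
  antidiagonalSum-geometric (suc n) x L = begin
    ((1# - x * q² ^ n) * q ^ L + S′) * q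
      ≈⟨ *-congʳ (+-congˡ (trans (antidiagonalSum-cong n (λ s b → solve 3 (λ A Q B → A :* (Q :* B) := Q :* (A :* B)) refl _ q _))
                                 (antidiagonalSum-*ˡ n q _))) ⟩
    ((1# - x * q² ^ n) * q ^ L + q * S) * q
      ≈⟨ ≈-modulo₃ (solve 7 (λ X Q P N QL Ss Q2n →
            ((con (+ 1) :- X :* Q2n) :* QL :+ Q :* Ss) :* Q
            := QL :* (con (+ 1) :+ Q :* N) :* (Q :- X :* (Q :* P))
               :+ Q :* (Ss :* Q :- QL :* N :* (Q :- X :* P))
               :+ (:- (X :* QL :* Q)) :* (Q2n :- P :* P)
               :+ (X :* Q :* P :* QL) :* ((con (+ 1) :+ Q :* N) :- (N :+ P))) refl x q (q ^ n) (qnum n) (q ^ L) S (q² ^ n))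
           (antidiagonalSum-geometric n x L) (^-distrib-* q q n) (qnum-suc n) ⟩
    q ^ L * (1# + q * qnum n) * (q - x * (q * q ^ n)) ∎
    where
    S = antidiagonalSum n (λ s b → (1# - x * q² ^ s) * q ^ (b ℕ.+ L))
    S′ = antidiagonalSum n (λ s b → (1# - x * q² ^ s) * q ^ (suc b ℕ.+ L))

  antidiagonalSum-geometric-suc : ¬ (q ≈ 0#) → ∀ n x L →
    antidiagonalSum (suc n) (λ s b → (1# - x * q² ^ s) * q ^ (b ℕ.+ L)) ≈ q ^ L * qnum (suc n) * (1# - x * q ^ n)
  antidiagonalSum-geometric-suc q≉0 n x L = *-cancelˡ-≉0 q≉0 (begin
    q * S                                         ≈⟨ *-comm q S ⟩
    S * q                                         ≈⟨ antidiagonalSum-geometric (suc n) x L ⟩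
    q ^ L * qnum (suc n) * (q - x * (q * q ^ n))
      ≈⟨ solve 5 (λ QL N X Q Qn → QL :* N :* (Q :- X :* (Q :* Qn)) := Q :* (QL :* N :* (con (+ 1) :- X :* Qn)))
           refl (q ^ L) (qnum (suc n)) x q (q ^ n) ⟩
    q * (q ^ L * qnum (suc n) * (1# - x * q ^ n)) ∎)
    where S = antidiagonalSum (suc n) (λ s b → (1# - x * q² ^ s) * q ^ (b ℕ.+ L))

  -- The a;q-weight as a function of y = a q^(2k-1).
  ω : Carrier → Carrier
  ω y = ((1# - y * q²) / (1# - y)) * (q ⁻¹)

  ω-cong : ∀ {y y′} → y ≈ y′ → ω y ≈ ω y′
  ω-cong e = *-congʳ (*-cong (+-congˡ (-‿cong (*-congʳ e))) (⁻¹-cong (+-congˡ (-‿cong e))))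

  ωProduct : Carrier → ℕ → Carrier
  ωProduct x zero    = 1#
  ωProduct x (suc s) = ωProduct x s * ω (x * q² ^ s)

  module _ (q≉0 : ¬ (q ≈ 0#)) {x} (factor≉0 : ∀ s → ¬ (1# - x * q² ^ s ≈ 0#)) where

    ωProduct-telescopes : ∀ s → ωProduct x s * (q ^ s * (1# - x)) ≈ 1# - x * q² ^ s
    ωProduct-telescopes zero = solve 1 (λ X → con (+ 1) :* (con (+ 1) :* (con (+ 1) :- X)) := con (+ 1) :- X :* con (+ 1)) refl x
    ωProduct-telescopes (suc s) = ≈-modulo₃ (solve 7 (λ X Q Qs Om I J Q2s →
          (Om :* ((con (+ 1) :- (X :* Q2s) :* (Q :* Q)) :* I :* J)) :* ((Q :* Qs) :* (con (+ 1) :- X))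
          := con (+ 1) :- X :* ((Q :* Q) :* Q2s)
             :+ (Q :* (con (+ 1) :- (X :* Q2s) :* (Q :* Q)) :* I :* J) :* (Om :* (Qs :* (con (+ 1) :- X)) :- (con (+ 1) :- X :* Q2s))
             :+ (Q :* J :* (con (+ 1) :- (X :* Q2s) :* (Q :* Q))) :* ((con (+ 1) :- X :* Q2s) :* I :- con (+ 1))
             :+ (con (+ 1) :- (X :* Q2s) :* (Q :* Q)) :* (Q :* J :- con (+ 1)))
          refl x q (q ^ s) (ωProduct x s) ((1# - x * q² ^ s) ⁻¹) (q ⁻¹) (q² ^ s))
       (ωProduct-telescopes s) (⁻¹-inverseʳ _ (factor≉0 s)) (⁻¹-inverseʳ q q≉0)

    ωProduct-shifts-poch : ∀ n → ωProduct x n * (q ^ n * poch x q² n) ≈ poch (x * q²) q² n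
    ωProduct-shifts-poch n = *-cancelˡ-≉0 (factor≉0 n) (begin
      u * (ωProduct x n * (q ^ n * poch x q² n))
        ≈⟨ solve 4 (λ U O Qn Pp → U :* (O :* (Qn :* Pp)) := O :* (Qn :* (Pp :* U))) refl u (ωProduct x n) (q ^ n) (poch x q² n) ⟩
      ωProduct x n * (q ^ n * poch x q² (suc n))
        ≈⟨ *-congˡ (*-congˡ (poch-unfoldˡ x q² n)) ⟩
      ωProduct x n * (q ^ n * ((1# - x) * poch (x * q²) q² n))
        ≈⟨ solve 4 (λ O Qn V Pp → O :* (Qn :* (V :* Pp)) := (O :* (Qn :* V)) :* Pp) refl (ωProduct x n) (q ^ n) (1# - x) (poch (x * q²) q² n) ⟩
      (ωProduct x n * (q ^ n * (1# - x))) * poch (x * q²) q² n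
        ≈⟨ *-congʳ (ωProduct-telescopes n) ⟩
      u * poch (x * q²) q² n ∎)
      where u = 1# - x * q² ^ n

  module _ (q≉0 : ¬ (q ≈ 0#)) (q^≉1 : ∀ n → ¬ (q ^ suc n ≈ 1#)) where

    private
      1-q≉0 : ¬ (1# - q ≈ 0#)
      1-q≉0 = 1-x≉0 (λ q≈1 → q^≉1 0 (trans (*-identityʳ q) q≈1))

      qnum-≉0 : ∀ n → ¬ (qnum (suc n) ≈ 0#)
      qnum-≉0 n h = 1-x≉0 (q^≉1 n) (trans (sym (qnum-*1-q (suc n))) (trans (*-congʳ h) (zeroˡ _)))

      qfactorial-≉0 : ∀ n → ¬ (qfactorial n ≈ 0#)
      qfactorial-≉0 zero    h = 0≉1 (sym h)
      qfactorial-≉0 (suc n)   = *-≉0 (qnum-≉0 n) (qfactorial-≉0 n)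

      qint≈qnum : ∀ n → qint q n ≈ qnum n
      qint≈qnum n = begin
        (1# - q ^ n) * (1# - q) ⁻¹           ≈⟨ *-congʳ (qnum-*1-q n) ⟨
        (qnum n * (1# - q)) * (1# - q) ⁻¹    ≈⟨ *-assoc _ _ _ ⟩
        qnum n * ((1# - q) * (1# - q) ⁻¹)    ≈⟨ *-congˡ (⁻¹-inverseʳ _ 1-q≉0) ⟩
        qnum n * 1#                          ≈⟨ *-identityʳ _ ⟩
        qnum n                               ∎

      qfact≈qfactorial : ∀ n → qfact q n ≈ qfactorial n
      qfact≈qfactorial zero    = refl
      qfact≈qfactorial (suc n) = *-cong (qint≈qnum (suc n)) (qfact≈qfactorial n)

      qfact-∸ : ∀ k d → qfact q ((k ℕ.+ d) ∸ k) ≈ qfactorial d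
      qfact-∸ k d = trans (reflexive (≡.cong (qfact q) (ℕP.m+n∸m≡n k d))) (qfact≈qfactorial d)

      x*y/y : ∀ x {y} → ¬ (y ≈ 0#) → (x * y) * y ⁻¹ ≈ x
      x*y/y x {y} y≉0 = trans (*-assoc _ _ _) (trans (*-congˡ (⁻¹-inverseʳ y y≉0)) (*-identityʳ x))

      gauss-ratio : ∀ k e → qnum (suc k) * gauss (suc k ℕ.+ e) (suc k) ≈ qnum (suc e) * gauss (suc k ℕ.+ e) k
      gauss-ratio k e = *-cancelˡ-≉0 (*-≉0 (^-≉0 q≉0 (suc k)) 1-q≉0) (≈-modulo₄ (solve 8 (λ Q Qs Qe QL N1 N2 G1 G0 →
           (Qs :* (con (+ 1) :- Q)) :* (N1 :* G1)
           := (Qs :* (con (+ 1) :- Q)) :* (N2 :* G0)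
              :+ con (+ 1) :* (Qs :* (con (+ 1) :- Qs) :* G1 :- (Qs :- QL) :* G0)
              :+ (:- G0) :* (QL :- Qs :* Qe)
              :+ (Qs :* G1) :* (N1 :* (con (+ 1) :- Q) :- (con (+ 1) :- Qs))
              :+ (:- (Qs :* G0)) :* (N2 :* (con (+ 1) :- Q) :- (con (+ 1) :- Qe)))
           refl q (q ^ suc k) (q ^ suc e) (q ^ suc (suc k ℕ.+ e)) (qnum (suc k)) (qnum (suc e))
                (gauss (suc k ℕ.+ e) (suc k)) (gauss (suc k ℕ.+ e) k))
         (gauss-absorption (suc k ℕ.+ e) k)
         (trans (reflexive (≡.cong (q ^_) (≡.sym (ℕP.+-suc (suc k) e)))) (^-+ q (suc k) (suc e)))
         (qnum-*1-q (suc k)) (qnum-*1-q (suc e)))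

      gauss-qfactorial : ∀ k e → gauss (k ℕ.+ e) k * (qfactorial k * qfactorial e) ≈ qfactorial (k ℕ.+ e)
      gauss-qfactorial zero    e = trans (*-congʳ (gauss-l0 e)) (trans (*-identityˡ _) (*-identityˡ _))
      gauss-qfactorial (suc k) e = begin
        G₁ * ((qnum (suc k) * qfactorial k) * qfactorial e)
          ≈⟨ solve 4 (λ A B C D → A :* ((B :* C) :* D) := (B :* A) :* (C :* D)) refl G₁ (qnum (suc k)) (qfactorial k) (qfactorial e) ⟩
        (qnum (suc k) * G₁) * (qfactorial k * qfactorial e)     ≈⟨ *-congʳ (gauss-ratio k e) ⟩
        (qnum (suc e) * G₀) * (qfactorial k * qfactorial e)
          ≈⟨ solve 4 (λ A B C D → (A :* B) :* (C :* D) := B :* (C :* (A :* D))) refl (qnum (suc e)) G₀ (qfactorial k) (qfactorial e) ⟩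
        G₀ * (qfactorial k * qfactorial (suc e))                ≡⟨ ≡.cong (λ w → gauss w k * (qfactorial k * qfactorial (suc e))) (ℕP.+-suc k e) ⟨
        gauss (k ℕ.+ suc e) k * (qfactorial k * qfactorial (suc e)) ≈⟨ gauss-qfactorial k (suc e) ⟩
        qfactorial (k ℕ.+ suc e)                                ≡⟨ ≡.cong qfactorial (ℕP.+-suc k e) ⟩
        qfactorial (suc k ℕ.+ e)                                ∎
        where
        G₁ = gauss (suc k ℕ.+ e) (suc k)
        G₀ = gauss (suc k ℕ.+ e) k

      <ᵇ≡false⇒+ : ∀ l k → (l <ᵇ k) ≡.≡ false → Σ ℕ (λ e → k ℕ.+ e ≡.≡ l)
      <ᵇ≡false⇒+ l       zero    _   = l , ≡.refl
      <ᵇ≡false⇒+ (suc l) (suc k) l≮k with <ᵇ≡false⇒+ l k l≮k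
      ... | e , k+e≡l = e , ≡.cong suc k+e≡l

      qbinom-cases : ∀ l k b → (l <ᵇ k) ≡.≡ b → (if b then 0# else (qfact q l / (qfact q k * qfact q (l ∸ k)))) ≈ gauss l k
      qbinom-cases l k true  l<k = sym (gauss-<ᵇ l k l<k)
      qbinom-cases l k false l≮k with <ᵇ≡false⇒+ l k l≮k
      ... | e , ≡.refl = begin
        qfact q (k ℕ.+ e) * (qfact q k * qfact q ((k ℕ.+ e) ∸ k)) ⁻¹
          ≈⟨ *-cong (qfact≈qfactorial (k ℕ.+ e)) (⁻¹-cong (*-cong (qfact≈qfactorial k) (qfact-∸ k e))) ⟩
        qfactorial (k ℕ.+ e) * (qfactorial k * qfactorial e) ⁻¹                       ≈⟨ *-congʳ (gauss-qfactorial k e) ⟨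
        (gauss (k ℕ.+ e) k * (qfactorial k * qfactorial e)) * (qfactorial k * qfactorial e) ⁻¹
          ≈⟨ x*y/y _ (*-≉0 (qfactorial-≉0 k) (qfactorial-≉0 e)) ⟩
        gauss (k ℕ.+ e) k                                                            ∎

    qbinom≈gauss : ∀ l k → qbinom q l k ≈ gauss l k
    qbinom≈gauss l k = qbinom-cases l k (l <ᵇ k) ≡.refl

    qfact-ratio≈qfalling : ∀ k d → qfact q (k ℕ.+ d) / qfact q ((k ℕ.+ d) ∸ k) ≈ qfalling k d
    qfact-ratio≈qfalling k d = begin
      qfact q (k ℕ.+ d) * qfact q ((k ℕ.+ d) ∸ k) ⁻¹
        ≈⟨ *-cong (qfact≈qfactorial (k ℕ.+ d)) (⁻¹-cong (qfact-∸ k d)) ⟩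
      qfactorial (k ℕ.+ d) * qfactorial d ⁻¹        ≈⟨ *-congʳ (qfactorial-+ k d) ⟩
      (qfalling k d * qfactorial d) * qfactorial d ⁻¹ ≈⟨ x*y/y _ (qfactorial-≉0 d) ⟩
      qfalling k d                                  ∎

module Placements where
  open import Data.Bool using (T) renaming (_≟_ to _≟ᵇ_)
  open import Data.Bool.Properties using (∧-zeroʳ; ∧-identityʳ; ∨-identityʳ; ∨-zeroʳ; ∧-distribˡ-∨)
  open import Data.Bool.ListAction using (any)
  open import Data.Vec using ([]; _∷_; lookup)
  open import Data.List using (List; []; _∷_; _++_; map; filter; concatMap; foldr; allFin; length; tabulate)
  open import Data.List.Properties using (map-tabulate)
  open import Data.Product using (_×_)
  open import Data.Unit using (⊤)
  open import Relation.Binary.PropositionalEquality using (_≡_; refl; sym; trans; cong; cong₂; subst)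

  count : ∀ {n} → (Fin n → Bool) → ℕ
  count {zero}  p = 0
  count {suc n} p = (if p Fin.zero then 1 else 0) ℕ.+ count (p ∘ Fin.suc)

  count-cong : ∀ {n} {p r : Fin n → Bool} → (∀ j → p j ≡ r j) → count p ≡ count r
  count-cong {zero}  e = refl
  count-cong {suc n} e = cong₂ (λ b k → (if b then 1 else 0) ℕ.+ k) (e Fin.zero) (count-cong (e ∘ Fin.suc))

  count-false : ∀ {n} (p : Fin n → Bool) → (∀ j → p j ≡ false) → count p ≡ 0
  count-false {zero}  p e = refl
  count-false {suc n} p e rewrite e Fin.zero = count-false (p ∘ Fin.suc) (e ∘ Fin.suc)

  count-true : ∀ {n} → count {n} (λ _ → true) ≡ n
  count-true {zero}  = refl
  count-true {suc n} = cong suc (count-true {n})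

  count-∨ : ∀ {n} (p r : Fin n → Bool) → (∀ j → (p j ∧ r j) ≡ false) → count (λ j → p j ∨ r j) ≡ count p ℕ.+ count r
  count-∨ {zero}  p r disjoint = refl
  count-∨ {suc n} p r disjoint with p Fin.zero in p₀ | r Fin.zero in r₀ | count-∨ (p ∘ Fin.suc) (r ∘ Fin.suc) (disjoint ∘ Fin.suc)
  ... | true  | true  | _  with () ← trans (sym (cong₂ _∧_ p₀ r₀)) (disjoint Fin.zero)
  ... | true  | false | ih = cong suc ih
  ... | false | true  | ih = trans (cong suc ih) (sym (ℕP.+-suc (count (p ∘ Fin.suc)) _))
  ... | false | false | ih = ih

  count+count-not : ∀ {n} (p : Fin n → Bool) → count p ℕ.+ count (not ∘ p) ≡ n
  count+count-not {zero}  p = refl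
  count+count-not {suc n} p with p Fin.zero
  ... | true  = cong suc (count+count-not (p ∘ Fin.suc))
  ... | false = trans (ℕP.+-suc (count (p ∘ Fin.suc)) _) (cong suc (count+count-not (p ∘ Fin.suc)))

  sumℕ : ∀ {n} → (Fin n → ℕ) → ℕ
  sumℕ {zero}  f = 0
  sumℕ {suc n} f = f Fin.zero ℕ.+ sumℕ (f ∘ Fin.suc)

  sumℕ-cong : ∀ {n} {f g : Fin n → ℕ} → (∀ j → f j ≡ g j) → sumℕ f ≡ sumℕ g
  sumℕ-cong {zero}  e = refl
  sumℕ-cong {suc n} e = cong₂ ℕ._+_ (e Fin.zero) (sumℕ-cong (e ∘ Fin.suc))

  sumℕ-zero : ∀ {n} (f : Fin n → ℕ) → (∀ j → f j ≡ 0) → sumℕ f ≡ 0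
  sumℕ-zero {zero}  f e = refl
  sumℕ-zero {suc n} f e rewrite e Fin.zero = sumℕ-zero (f ∘ Fin.suc) (e ∘ Fin.suc)

  anyᶠ : ∀ {n} → (Fin n → Bool) → Bool
  anyᶠ {zero}  p = false
  anyᶠ {suc n} p = p Fin.zero ∨ anyᶠ (p ∘ Fin.suc)

  anyᶠ-false : ∀ {n} → anyᶠ {n} (λ _ → false) ≡ false
  anyᶠ-false {zero}  = refl
  anyᶠ-false {suc n} = anyᶠ-false {n}

  module _ {A : Set} where

    countL : (A → Bool) → List A → ℕ
    countL b []       = 0
    countL b (x ∷ xs) = (if b x then 1 else 0) ℕ.+ countL b xs

    length-filter : ∀ (b : A → Bool) xs → length (filter (λ x → b x ≟ᵇ true) xs) ≡ countL b xs
    length-filter b [] = refl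
    length-filter b (x ∷ xs) with b x
    ... | true  = cong suc (length-filter b xs)
    ... | false = length-filter b xs

    countL-++ : ∀ b xs ys → countL b (xs ++ ys) ≡ countL b xs ℕ.+ countL b ys
    countL-++ b []       ys = refl
    countL-++ b (x ∷ xs) ys = trans (cong (_ ℕ.+_) (countL-++ b xs ys)) (sym (ℕP.+-assoc (if b x then 1 else 0) _ _))

    countL-tabulate : ∀ {n} (b : A → Bool) (t : Fin n → A) → countL b (tabulate t) ≡ count (b ∘ t)
    countL-tabulate {zero}  b t = refl
    countL-tabulate {suc n} b t = cong (_ ℕ.+_) (countL-tabulate b (t ∘ Fin.suc))

    any-tabulate : ∀ {n} (b : A → Bool) (t : Fin n → A) → any b (tabulate t) ≡ anyᶠ (b ∘ t)
    any-tabulate {zero}  b t = refl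
    any-tabulate {suc n} b t = cong (b (t Fin.zero) ∨_) (any-tabulate b (t ∘ Fin.suc))

    any-∨ : ∀ (p r : A → Bool) xs → any (λ x → p x ∨ r x) xs ≡ (any p xs ∨ any r xs)
    any-∨ p r [] = refl
    any-∨ p r (x ∷ xs) with p x | r x
    ... | true  | _     = refl
    ... | false | true  = sym (∨-zeroʳ (any p xs))
    ... | false | false = any-∨ p r xs

    any-cong : ∀ {p r : A → Bool} → (∀ x → p x ≡ r x) → ∀ xs → any p xs ≡ any r xs
    any-cong e []       = refl
    any-cong e (x ∷ xs) = cong₂ _∨_ (e x) (any-cong e xs)

    any-false : ∀ (xs : List A) → any (λ _ → false) xs ≡ false
    any-false []       = refl
    any-false (x ∷ xs) = any-false xs

  countL-concatMap : ∀ {A B : Set} (b : B → Bool) (h : A → List B) xs →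
    countL b (concatMap h xs) ≡ foldr (λ x r → countL b (h x) ℕ.+ r) 0 xs
  countL-concatMap b h []       = refl
  countL-concatMap b h (x ∷ xs) = trans (countL-++ b (h x) (concatMap h xs)) (cong (countL b (h x) ℕ.+_) (countL-concatMap b h xs))

  foldr-+-tabulate : ∀ {A : Set} {n} (f : A → ℕ) (t : Fin n → A) → foldr (λ x r → f x ℕ.+ r) 0 (tabulate t) ≡ sumℕ (f ∘ t)
  foldr-+-tabulate {n = zero}  f t = refl
  foldr-+-tabulate {n = suc n} f t = cong (f (t Fin.zero) ℕ.+_) (foldr-+-tabulate f (t ∘ Fin.suc))

  eqFin-true : ∀ {m} {i j : Fin m} → eqFin i j ≡ true → i ≡ j
  eqFin-true {i = i} {j} e with i Fin.≟ j
  ... | yes i≡j = i≡j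

  eqFin-sym : ∀ {m} (i j : Fin m) → eqFin i j ≡ eqFin j i
  eqFin-sym i j with i Fin.≟ j | j Fin.≟ i
  ... | yes _   | yes _   = refl
  ... | no _    | no _    = refl
  ... | yes i≡j | no j≢i  with () ← j≢i (sym i≡j)
  ... | no i≢j  | yes j≡i with () ← i≢j (sym j≡i)

  <ᵇ-trans : ∀ x y z → (x <ᵇ y) ≡ true → (y <ᵇ z) ≡ true → (x <ᵇ z) ≡ true
  <ᵇ-trans x y z x<y y<z = <⇒<ᵇ (ℕP.<-trans (ℕP.<ᵇ⇒< x y (subst T (sym x<y) _)) (ℕP.<ᵇ⇒< y z (subst T (sym y<z) _)))
    where
    <⇒<ᵇ : ∀ {x y} → x ℕ.< y → (x <ᵇ y) ≡ true
    <⇒<ᵇ {zero}  {suc y} _             = refl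
    <⇒<ᵇ {suc x} {suc y} (ℕ.s≤s x<y) = <⇒<ᵇ x<y

  ≢∧≮⇒> : ∀ {m} (j j₀ : Fin m) → (not (eqFin j j₀) ∧ not (toℕ j <ᵇ toℕ j₀)) ≡ (toℕ j₀ <ᵇ toℕ j)
  ≢∧≮⇒> Fin.zero    Fin.zero     = refl
  ≢∧≮⇒> Fin.zero    (Fin.suc j₀) = refl
  ≢∧≮⇒> (Fin.suc j) Fin.zero     = refl
  ≢∧≮⇒> (Fin.suc j) (Fin.suc j₀) = ≢∧≮⇒> j j₀

  -- The rows already occupied by rooks of the columns to the left.
  RowSet : ℕ → Set
  RowSet m = Fin m → Bool

  _⊕_ : ∀ {m} → RowSet m → Maybe (Fin m) → RowSet m
  D ⊕ nothing = D
  D ⊕ just j₀ = λ j → D j ∨ eqFin j j₀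

  Fresh : ∀ {m} → RowSet m → Maybe (Fin m) → Set
  Fresh D nothing   = ⊤
  Fresh D (just j₀) = D j₀ ≡ false

  occupiedAbove : ∀ {m} → RowSet m → Fin m → ℕ
  occupiedAbove D j = count (λ j′ → (toℕ j <ᵇ toℕ j′) ∧ D j′)

  freeRows : ∀ {m} → RowSet m → ℕ
  freeRows D = count (not ∘ D)

  freeAbove : ∀ {m} → RowSet m → Fin m → ℕ
  freeAbove D j = count (λ j′ → (toℕ j <ᵇ toℕ j′) ∧ not (D j′))

  freeBelow : ∀ {m} → RowSet m → Fin m → ℕ
  freeBelow D j = count (λ j′ → (toℕ j′ <ᵇ toℕ j) ∧ not (D j′))

  occupiedAbove-⊕ : ∀ {m} (D : RowSet m) j₀ → D j₀ ≡ false → ∀ j →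
    occupiedAbove (D ⊕ just j₀) j ≡ occupiedAbove D j ℕ.+ count (λ j′ → (toℕ j <ᵇ toℕ j′) ∧ eqFin j′ j₀)
  occupiedAbove-⊕ D j₀ j₀-free j =
    trans (count-cong (λ j′ → ∧-distribˡ-∨ (toℕ j <ᵇ toℕ j′) (D j′) (eqFin j′ j₀)))
          (count-∨ _ _ (λ j′ → disjoint (toℕ j <ᵇ toℕ j′) (D j′) (eqFin j′ j₀) (j₀-only j′)))
    where
    j₀-only : ∀ j′ → (D j′ ∧ eqFin j′ j₀) ≡ false
    j₀-only j′ with eqFin j′ j₀ in e
    ... | false = ∧-zeroʳ (D j′)
    ... | true with refl ← eqFin-true {i = j′} {j₀} e = trans (∧-identityʳ (D j₀)) j₀-free
    disjoint : ∀ u d e → (d ∧ e) ≡ false → ((u ∧ d) ∧ (u ∧ e)) ≡ false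
    disjoint false d e _  = refl
    disjoint true  d e de = de

  rows-around : ∀ {m} (D : RowSet m) (j : Fin m) → suc (toℕ j ℕ.+ occupiedAbove D j ℕ.+ freeAbove D j) ≡ m
  rows-around {suc m} D Fin.zero    = cong suc (count+count-not (D ∘ Fin.suc))
  rows-around {suc m} D (Fin.suc j) = cong suc (rows-around (D ∘ Fin.suc) j)

  freeBelow-zero : ∀ {m} (D : RowSet (suc m)) → freeBelow D Fin.zero ≡ 0
  freeBelow-zero {m} D = count-false {m} (λ _ → false) (λ _ → refl)

  free-around : ∀ {m} (D : RowSet m) (j : Fin m) → D j ≡ false → suc (freeAbove D j ℕ.+ freeBelow D j) ≡ freeRows D
  free-around {suc m} D Fin.zero j-free =
    trans (cong (λ z → suc (freeRows (D ∘ Fin.suc) ℕ.+ z)) (freeBelow-zero D))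
          (trans (cong suc (ℕP.+-identityʳ _)) (cong (λ b → (if not b then 1 else 0) ℕ.+ freeRows (D ∘ Fin.suc)) (sym j-free)))
  free-around {suc m} D (Fin.suc j) j-free = step (D Fin.zero) (free-around (D ∘ Fin.suc) j j-free)
    where
    step : ∀ b → suc (freeAbove (D ∘ Fin.suc) j ℕ.+ freeBelow (D ∘ Fin.suc) j) ≡ freeRows (D ∘ Fin.suc) →
      suc (freeAbove (D ∘ Fin.suc) j ℕ.+ ((if not b then 1 else 0) ℕ.+ freeBelow (D ∘ Fin.suc) j))
        ≡ (if not b then 1 else 0) ℕ.+ freeRows (D ∘ Fin.suc)
    step true  e = e
    step false e = trans (cong suc (ℕP.+-suc _ _)) (cong suc e)

  freeRows-⊕ : ∀ {m} (D : RowSet m) j₀ → D j₀ ≡ false → freeRows D ≡ suc (freeRows (D ⊕ just j₀))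
  freeRows-⊕ D j₀ j₀-free =
    trans (count-cong split) (trans (count-∨ _ _ disjoint) (trans (cong (freeRows (D ⊕ just j₀) ℕ.+_) (count-single j₀)) (ℕP.+-comm _ 1)))
    where
    count-single : ∀ {m} (j₀ : Fin m) → count (λ j → eqFin j j₀) ≡ 1
    count-single {suc m} Fin.zero     = cong suc (count-false {m} (λ _ → false) (λ _ → refl))
    count-single {suc m} (Fin.suc j₀) = count-single j₀
    split : ∀ j → not (D j) ≡ (not (D j ∨ eqFin j j₀) ∨ eqFin j j₀)
    split j with eqFin j j₀ in e
    ... | false = sym (trans (∨-identityʳ _) (cong not (∨-identityʳ (D j))))
    ... | true with refl ← eqFin-true {i = j} {j₀} e = trans (cong not j₀-free) (sym (∨-zeroʳ _))
    disjoint : ∀ j → (not (D j ∨ eqFin j j₀) ∧ eqFin j j₀) ≡ false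
    disjoint j with D j | eqFin j j₀
    ... | true  | _     = refl
    ... | false | true  = refl
    ... | false | false = refl

  cancelledBelow : ∀ {m} → Fin m → Maybe (Fin m) → Bool
  cancelledBelow j nothing   = false
  cancelledBelow j (just j₀) = toℕ j <ᵇ toℕ j₀

  cancelledᶠ : ∀ {l m} → Placement l m → Fin l → Fin m → Bool
  cancelledᶠ P i j = anyᶠ (λ i′ → (toℕ i′ <ᵇ toℕ i) ∧ rookAt P i′ j) ∨ cancelledBelow j (lookup P i)

  cancelled≡cancelledᶠ : ∀ {l m} (P : Placement l m) i j → cancelled P i j ≡ cancelledᶠ P i j
  cancelled≡cancelledᶠ P i j with lookup P i
  ... | nothing = cong (_∨ false) (any-tabulate (λ i′ → (toℕ i′ <ᵇ toℕ i) ∧ rookAt P i′ j) id)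
  ... | just j₀ = cong (_∨ (toℕ j <ᵇ toℕ j₀)) (any-tabulate (λ i′ → (toℕ i′ <ᵇ toℕ i) ∧ rookAt P i′ j) id)

  rcountᶠ : ∀ {l m} → Placement l m → Fin l → Fin m → ℕ
  rcountᶠ P i j = sumℕ (λ i′ → count (λ j′ → (toℕ i′ <ᵇ toℕ i) ∧ ((toℕ j <ᵇ toℕ j′) ∧ rookAt P i′ j′)))

  rcount≡rcountᶠ : ∀ {l m} (P : Placement l m) i j → rcount P i j ≡ rcountᶠ P i j
  rcount≡rcountᶠ {l} {m} P i j =
    trans (length-filter b (cells l m)) (trans (countL-concatMap b column (allFin l)) (trans (foldr-+-tabulate (countL b ∘ column) id)
      (sumℕ-cong (λ i′ → trans (cong (countL b) (map-tabulate id (i′ ,_))) (countL-tabulate b (i′ ,_))))))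
    where
    b : Fin l × Fin m → Bool
    b c = (toℕ (proj₁ c) <ᵇ toℕ i) ∧ (toℕ j <ᵇ toℕ (proj₂ c)) ∧ rookAt P (proj₁ c) (proj₂ c)
    column : Fin l → List (Fin l × Fin m)
    column i′ = map (i′ ,_) (allFin m)

  validOn : ∀ {l m} → RowSet m → ℕ → Placement l m → Bool
  validOn D k       []           = does (0 ℕ.≟ k)
  validOn D k       (nothing ∷ P) = validOn D k P
  validOn D zero    (just j ∷ P) = false
  validOn D (suc k) (just j ∷ P) = not (D j) ∧ validOn (D ⊕ just j) k P

  validOn≡isNk∧avoids : ∀ {l m} (D : RowSet m) k (P : Placement l m) →
    validOn D k P ≡ (isNk k P ∧ not (any D (rooks P)))
  validOn≡isNk∧avoids D k       []           = sym (trans (∧-identityʳ _) (∧-identityʳ _))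
  validOn≡isNk∧avoids D k       (nothing ∷ P) = validOn≡isNk∧avoids D k P
  validOn≡isNk∧avoids D zero    (just j ∷ P) = refl
  validOn≡isNk∧avoids D (suc k) (just j ∷ P) =
    trans (cong (not (D j) ∧_) (validOn≡isNk∧avoids (D ⊕ just j) k P))
     (trans (cong (λ z → not (D j) ∧ (isNk k P ∧ not z))
                  (trans (any-cong (λ x → cong (D x ∨_) (eqFin-sym x j)) (rooks P)) (any-∨ D (eqFin j) (rooks P))))
            (rearrange (D j) (does (length (rooks P) ℕ.≟ k)) (distinctᵇ (rooks P)) (any D (rooks P)) (any (eqFin j) (rooks P))))
    where
    rearrange : ∀ d a b e f → (not d ∧ ((a ∧ b) ∧ not (e ∨ f))) ≡ ((a ∧ (not f ∧ b)) ∧ not (d ∨ e))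
    rearrange true  a b e     f     = sym (∧-zeroʳ _)
    rearrange false a b true  f     = trans (∧-zeroʳ _) (sym (∧-zeroʳ _))
    rearrange false a b false true  = trans (∧-zeroʳ _) (sym (trans (∧-identityʳ _) (∧-zeroʳ a)))
    rearrange false a b false false = refl

  isNk≡validOn : ∀ {l m} k (P : Placement l m) → isNk k P ≡ validOn (λ _ → false) k P
  isNk≡validOn k P = sym (trans (validOn≡isNk∧avoids (λ _ → false) k P)
    (trans (cong (λ z → isNk k P ∧ not z) (any-false (rooks P))) (∧-identityʳ _)))

module RookSums {c ℓ} (K : Field c ℓ) (a q : Field.Carrier K) where
  open import Data.Bool using () renaming (_≟_ to _≟ᵇ_)
  open import Data.Bool.Properties using (∧-zeroʳ; ∨-assoc)
  open import Data.Vec using ([]; _∷_)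
  open import Data.List using (List; []; _∷_; _++_; map; filter; concatMap; allFin; tabulate)
  open import Data.List.Properties using (map-tabulate)
  open import Data.Product using (_×_)
  open Placements

  open Field K hiding (zero)
  open FieldOps K
  open Rook K
  open import Algebra.Properties.Semiring.Sum semiring using (sum; sum-cong-≋; ∑-distrib-+; *-distribʳ-sum; sum-replicate-zero)
  open import Algebra.Properties.CommutativeMonoid.Sum *-commutativeMonoid using ()
    renaming (sum to product; sum-cong-≋ to product-cong)
  open import Relation.Binary.Reasoning.Setoid setoid

  module _ {A : Set} where

    sumOver : List A → (A → Carrier) → Carrier
    sumOver xs f = sumL (map f xs)

    sumOver-cong : ∀ xs {f g : A → Carrier} → (∀ x → f x ≈ g x) → sumOver xs f ≈ sumOver xs g
    sumOver-cong []       e = refl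
    sumOver-cong (x ∷ xs) e = +-cong (e x) (sumOver-cong xs e)

    sumOver-+ : ∀ xs (f g : A → Carrier) → sumOver xs (λ x → f x + g x) ≈ sumOver xs f + sumOver xs g
    sumOver-+ []       f g = sym (+-identityˡ 0#)
    sumOver-+ (x ∷ xs) f g = begin
      (f x + g x) + sumOver xs (λ x → f x + g x)     ≈⟨ +-congˡ (sumOver-+ xs f g) ⟩
      (f x + g x) + (sumOver xs f + sumOver xs g)   ≈⟨ +-assoc (f x) (g x) _ ⟩
      f x + (g x + (sumOver xs f + sumOver xs g))   ≈⟨ +-congˡ (+-assoc (g x) _ _) ⟨
      f x + ((g x + sumOver xs f) + sumOver xs g)   ≈⟨ +-congˡ (+-congʳ (+-comm (g x) _)) ⟩
      f x + ((sumOver xs f + g x) + sumOver xs g)   ≈⟨ +-congˡ (+-assoc _ (g x) _) ⟩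
      f x + (sumOver xs f + (g x + sumOver xs g))   ≈⟨ +-assoc (f x) _ _ ⟨
      (f x + sumOver xs f) + (g x + sumOver xs g)   ∎

    sumOver-*ˡ : ∀ xs (y : Carrier) (f : A → Carrier) → sumOver xs (λ x → y * f x) ≈ y * sumOver xs f
    sumOver-*ˡ []       y f = sym (zeroʳ y)
    sumOver-*ˡ (x ∷ xs) y f = trans (+-congˡ (sumOver-*ˡ xs y f)) (sym (distribˡ y _ _))

    sumOver-zero : ∀ xs → sumOver xs (λ _ → 0#) ≈ 0#
    sumOver-zero []       = refl
    sumOver-zero (x ∷ xs) = trans (+-identityˡ _) (sumOver-zero xs)

    sumOver-sum : ∀ {n} xs (f : Fin n → A → Carrier) → sumOver xs (λ x → sum (λ j → f j x)) ≈ sum (λ j → sumOver xs (f j))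
    sumOver-sum {n} []       f = sym (sum-replicate-zero n)
    sumOver-sum     (x ∷ xs) f = trans (+-congˡ (sumOver-sum xs f)) (sym (∑-distrib-+ (λ j → f j x) (λ j → sumOver xs (f j))))

    sumL-tabulate : ∀ {n} (g : A → Carrier) (t : Fin n → A) → sumL (map g (tabulate t)) ≈ sum (g ∘ t)
    sumL-tabulate {zero}  g t = refl
    sumL-tabulate {suc n} g t = +-congˡ (sumL-tabulate g (t ∘ Fin.suc))

    prodL-tabulate : ∀ {n} (g : A → Carrier) (t : Fin n → A) → prodL (map g (tabulate t)) ≈ product (g ∘ t)
    prodL-tabulate {zero}  g t = refl
    prodL-tabulate {suc n} g t = *-congˡ (prodL-tabulate g (t ∘ Fin.suc))

    sumL-++ : ∀ (g : A → Carrier) xs ys → sumL (map g (xs ++ ys)) ≈ sumL (map g xs) + sumL (map g ys)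
    sumL-++ g []       ys = sym (+-identityˡ _)
    sumL-++ g (x ∷ xs) ys = trans (+-congˡ (sumL-++ g xs ys)) (sym (+-assoc _ _ _))

    prodL-++ : ∀ (g : A → Carrier) xs ys → prodL (map g (xs ++ ys)) ≈ prodL (map g xs) * prodL (map g ys)
    prodL-++ g []       ys = sym (*-identityˡ _)
    prodL-++ g (x ∷ xs) ys = trans (*-congˡ (prodL-++ g xs ys)) (sym (*-assoc _ _ _))

    sumL-filter : ∀ (b : A → Bool) (g : A → Carrier) xs →
      sumL (map g (filter (λ x → b x ≟ᵇ true) xs)) ≈ sumOver xs (λ x → if b x then g x else 0#)
    sumL-filter b g [] = refl
    sumL-filter b g (x ∷ xs) with b x
    ... | true  = +-congˡ (sumL-filter b g xs)
    ... | false = trans (sumL-filter b g xs) (sym (+-identityˡ _))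

    prodL-filter : ∀ (b : A → Bool) (g : A → Carrier) xs →
      prodL (map g (filter (λ x → b x ≟ᵇ true) xs)) ≈ prodL (map (λ x → if b x then g x else 1#) xs)
    prodL-filter b g [] = refl
    prodL-filter b g (x ∷ xs) with b x
    ... | true  = *-congˡ (prodL-filter b g xs)
    ... | false = trans (prodL-filter b g xs) (sym (*-identityˡ _))

  module _ {A B : Set} where

    sumL-concatMap : ∀ (g : B → Carrier) (h : A → List B) xs → sumL (map g (concatMap h xs)) ≈ sumOver xs (λ x → sumL (map g (h x)))
    sumL-concatMap g h []       = refl
    sumL-concatMap g h (x ∷ xs) = trans (sumL-++ g (h x) (concatMap h xs)) (+-congˡ (sumL-concatMap g h xs))

    prodL-concatMap : ∀ (g : B → Carrier) (h : A → List B) xs → prodL (map g (concatMap h xs)) ≈ prodL (map (λ x → prodL (map g (h x))) xs)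
    prodL-concatMap g h []       = refl
    prodL-concatMap g h (x ∷ xs) = trans (prodL-++ g (h x) (concatMap h xs)) (*-congˡ (prodL-concatMap g h xs))

  sumOver-allPlacements-suc : ∀ {l m} (f : Placement (suc l) m → Carrier) →
    sumOver (allPlacements (suc l) m) f ≈ sumOver (allPlacements l m) (λ P → f (nothing ∷ P) + sum (λ j → f (just j ∷ P)))
  sumOver-allPlacements-suc {l} {m} f =
    trans (sumL-concatMap f extensions (allPlacements l m)) (sumOver-cong (allPlacements l m) (λ P → +-congˡ (rook-rows P)))
    where
    extensions : Placement l m → List (Placement (suc l) m)
    extensions P = map (_∷ P) (nothing ∷ map just (allFin m))
    rook-rows : ∀ P → sumL (map f (map (_∷ P) (map just (allFin m)))) ≈ sum (λ j → f (just j ∷ P))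
    rook-rows P = trans (reflexive (≡.cong (λ xs → sumL (map f (map (_∷ P) xs))) (map-tabulate id just)))
      (trans (reflexive (≡.cong (sumL ∘ map f) (map-tabulate just (_∷ P)))) (sumL-tabulate f (λ j → just j ∷ P)))

  -- weightOn D c P is the weight P receives as the last l columns of a board
  -- whose first c columns hold rooks in the rows D: those rows are cancelled,
  -- and their rooks count towards r_(i,j) of every cell below them.
  shiftedIndex : ∀ {l m} → RowSet m → ℤ → Placement l m → Fin l → Fin m → ℤ
  shiftedIndex D c P i j = ((c ℤ.+ + toℕ i) ℤ.- + toℕ j) ℤ.- + (occupiedAbove D j ℕ.+ rcountᶠ P i j)

  cellWeight : ∀ {l m} → RowSet m → ℤ → Placement l m → Fin l → Fin m → Carrier
  cellWeight D c P i j =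
    if not (rookAt P i j) ∧ not (D j ∨ cancelledᶠ P i j) then weight a q (shiftedIndex D c P i j) else 1#

  weightOn : ∀ {l m} → RowSet m → ℤ → Placement l m → Carrier
  weightOn D c P = product (λ i → product (λ j → cellWeight D c P i j))

  placementWeight≈weightOn : ∀ {l m} (P : Placement l m) → placementWeight a q P ≈ weightOn (λ _ → false) (+ 0) P
  placementWeight≈weightOn {l} {m} P = begin
    placementWeight a q P                                       ≈⟨ prodL-filter (λ c → inU P (proj₁ c) (proj₂ c)) w (cells l m) ⟩
    prodL (map (λ c → cw (proj₁ c) (proj₂ c)) (cells l m))      ≈⟨ prodL-concatMap _ column (allFin l) ⟩
    prodL (map (λ i → prodL (map (λ c → cw (proj₁ c) (proj₂ c)) (column i))) (allFin l))
      ≈⟨ prodL-tabulate (λ i → prodL (map (λ c → cw (proj₁ c) (proj₂ c)) (column i))) id ⟩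
    product (λ i → prodL (map (λ c → cw (proj₁ c) (proj₂ c)) (column i)))
      ≈⟨ product-cong (λ i → trans (reflexive (≡.cong (λ xs → prodL (map (λ c → cw (proj₁ c) (proj₂ c)) xs)) (map-tabulate id (i ,_))))
                                   (prodL-tabulate (λ c → cw (proj₁ c) (proj₂ c)) (i ,_))) ⟩
    product (λ i → product (λ j → cw i j))                       ≈⟨ product-cong (λ i → product-cong (λ j → reflexive (cw≡cellWeight i j))) ⟩
    weightOn (λ _ → false) (+ 0) P                                ∎
    where
    w : Fin l × Fin m → Carrier
    w c = weight a q (((+ toℕ (proj₁ c)) ℤ.- (+ toℕ (proj₂ c))) ℤ.- (+ rcount P (proj₁ c) (proj₂ c)))
    cw : Fin l → Fin m → Carrier
    cw i j = if inU P i j then w (i , j) else 1#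
    column : Fin l → List (Fin l × Fin m)
    column i = map (i ,_) (allFin m)
    cw≡cellWeight : ∀ i j → cw i j ≡.≡ cellWeight (λ _ → false) (+ 0) P i j
    cw≡cellWeight i j = ≡.cong₂ (λ b z → if not (rookAt P i j) ∧ not b then weight a q z else 1#) (cancelled≡cancelledᶠ P i j)
      (≡.cong (λ r → ((+ toℕ i) ℤ.- (+ toℕ j)) ℤ.- (+ r))
        (≡.trans (rcount≡rcountᶠ P i j) (≡.cong (ℕ._+ rcountᶠ P i j) (≡.sym (count-false {m} _ (λ j′ → ∧-zeroʳ _))))))

  occupies : ∀ {m} → Maybe (Fin m) → Fin m → Bool
  occupies nothing   j = false
  occupies (just j₀) j = eqFin j j₀

  columnWeight : ∀ {m} → RowSet m → ℤ → Maybe (Fin m) → Fin m → Carrier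
  columnWeight D c o j =
    if not (occupies o j) ∧ not (D j ∨ cancelledBelow j o) then weight a q ((c ℤ.- + toℕ j) ℤ.- + occupiedAbove D j) else 1#

  private
    first-column-index : ∀ {l m} (D : RowSet m) c (P : Placement (suc l) m) j →
      shiftedIndex D c P Fin.zero j ≡.≡ (c ℤ.- + toℕ j) ℤ.- + occupiedAbove D j
    first-column-index {l} {m} D c P j = ≡.cong₂ (λ u v → (u ℤ.- + toℕ j) ℤ.- + v) (ℤP.+-identityʳ c)
      (≡.trans (≡.cong (occupiedAbove D j ℕ.+_) (sumℕ-zero {suc l} _ (λ _ → count-false {m} (λ _ → false) (λ _ → ≡.refl))))
               (ℕP.+-identityʳ _))

  cellWeight-head : ∀ {l m} (D : RowSet m) c (o : Maybe (Fin m)) (P : Placement l m) j →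
    cellWeight D c (o ∷ P) Fin.zero j ≡.≡ columnWeight D c o j
  cellWeight-head {l} {m} D c nothing   P j = ≡.cong₂ (λ b z → if not false ∧ not (D j ∨ (b ∨ false)) then weight a q z else 1#)
    (anyᶠ-false {suc l}) (first-column-index D c (nothing ∷ P) j)
  cellWeight-head {l} {m} D c (just j₀) P j = ≡.cong₂ (λ b z → if not (eqFin j j₀) ∧ not (D j ∨ (b ∨ (toℕ j <ᵇ toℕ j₀))) then weight a q z else 1#)
    (anyᶠ-false {suc l}) (first-column-index D c (just j₀ ∷ P) j)

  cellWeight-tail : ∀ {l m} (D : RowSet m) c (o : Maybe (Fin m)) (P : Placement l m) → Fresh D o → ∀ i j →
    cellWeight D c (o ∷ P) (Fin.suc i) j ≡.≡ cellWeight (D ⊕ o) (c ℤ.+ + 1) P i j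
  cellWeight-tail {l} {m} D c nothing P _ i j =
    ≡.cong (λ z → if not (rookAt P i j) ∧ not (D j ∨ cancelledᶠ P i j) then weight a q z else 1#)
      (≡.cong₂ (λ u v → (u ℤ.- + toℕ j) ℤ.- + v) (≡.sym (ℤP.+-assoc c (+ 1) (+ toℕ i)))
               (≡.cong (λ r → occupiedAbove D j ℕ.+ (r ℕ.+ rcountᶠ P i j)) (count-false {m} _ (λ j′ → ∧-zeroʳ _))))
  cellWeight-tail {l} {m} D c (just j₀) P j₀-free i j =
    ≡.cong₂ (λ b z → if not (rookAt P i j) ∧ not b then weight a q z else 1#)
      (≡.trans (≡.cong (D j ∨_) (∨-assoc (eqFin j j₀) _ _)) (≡.sym (∨-assoc (D j) (eqFin j j₀) _)))
      (≡.cong₂ (λ u v → (u ℤ.- + toℕ j) ℤ.- + v) (≡.sym (ℤP.+-assoc c (+ 1) (+ toℕ i)))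
               (≡.trans (≡.sym (ℕP.+-assoc (occupiedAbove D j) _ (rcountᶠ P i j)))
                        (≡.cong (ℕ._+ rcountᶠ P i j) (≡.sym (occupiedAbove-⊕ D j₀ j₀-free j)))))

  weightOn-∷ : ∀ {l m} (D : RowSet m) c (o : Maybe (Fin m)) (P : Placement l m) → Fresh D o →
    weightOn D c (o ∷ P) ≈ product (columnWeight D c o) * weightOn (D ⊕ o) (c ℤ.+ + 1) P
  weightOn-∷ D c o P fresh = *-cong (product-cong (λ j → reflexive (cellWeight-head D c o P j)))
    (product-cong (λ i → product-cong (λ j → reflexive (cellWeight-tail D c o P fresh i j))))

  rookSum : ∀ {m} → RowSet m → ℤ → ℕ → ℕ → Carrier
  rookSum {m} D c l k = sumOver (allPlacements l m) (λ P → if validOn D k P then weightOn D c P else 0#)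

  rookNumber≈rookSum : ∀ l m k → rookNumber a q l m k ≈ rookSum (λ _ → false) (+ 0) l k
  rookNumber≈rookSum l m k = trans (sumL-filter (isNk k) (placementWeight a q) (allPlacements l m))
    (sumOver-cong (allPlacements l m) (λ P → trans (reflexive (≡.cong (λ b → if b then placementWeight a q P else 0#) (isNk≡validOn k P)))
                                                    (if-cong (validOn (λ _ → false) k P) (placementWeight≈weightOn P))))
    where
    if-cong : ∀ b {x y} → x ≈ y → (if b then x else 0#) ≈ (if b then y else 0#)
    if-cong true  e = e
    if-cong false e = refl

  private
    term-empty : ∀ {l m} (D : RowSet m) c k (P : Placement l m) →
      (if validOn D k (nothing ∷ P) then weightOn D c (nothing ∷ P) else 0#)
        ≈ product (columnWeight D c nothing) * (if validOn D k P then weightOn D (c ℤ.+ + 1) P else 0#)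
    term-empty D c k P with validOn D k P
    ... | true  = weightOn-∷ D c nothing P _
    ... | false = sym (zeroʳ _)

    term-rook : ∀ {l m} (D : RowSet m) c k j (P : Placement l m) →
      (if validOn D (suc k) (just j ∷ P) then weightOn D c (just j ∷ P) else 0#) ≈
      (if D j then 0# else product (columnWeight D c (just j)) * (if validOn (D ⊕ just j) k P then weightOn (D ⊕ just j) (c ℤ.+ + 1) P else 0#))
    term-rook D c k j P with D j in j-occupied
    ... | true = refl
    ... | false with validOn (D ⊕ just j) k P
    ...   | true  = weightOn-∷ D c (just j) P j-occupied
    ...   | false = sym (zeroʳ _)

  rookSum-suc-zero : ∀ {m} (D : RowSet m) c l → rookSum D c (suc l) 0 ≈ product (columnWeight D c nothing) * rookSum D (c ℤ.+ + 1) l 0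
  rookSum-suc-zero {m} D c l = begin
    rookSum D c (suc l) 0                                        ≈⟨ sumOver-allPlacements-suc t ⟩
    sumOver Ps (λ P → t (nothing ∷ P) + sum (λ j → t (just j ∷ P))) ≈⟨ sumOver-cong Ps (λ P → trans (+-congˡ (sum-replicate-zero m)) (+-identityʳ _)) ⟩
    sumOver Ps (λ P → t (nothing ∷ P))                           ≈⟨ sumOver-cong Ps (term-empty D c 0) ⟩
    sumOver Ps (λ P → product (columnWeight D c nothing) * (if validOn D 0 P then weightOn D (c ℤ.+ + 1) P else 0#)) ≈⟨ sumOver-*ˡ Ps _ _ ⟩
    product (columnWeight D c nothing) * rookSum D (c ℤ.+ + 1) l 0 ∎
    where
    Ps = allPlacements l m
    t : Placement (suc l) m → Carrier
    t P = if validOn D 0 P then weightOn D c P else 0#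

  rookSum-suc-suc : ∀ {m} (D : RowSet m) c l k → rookSum D c (suc l) (suc k) ≈
    product (columnWeight D c nothing) * rookSum D (c ℤ.+ + 1) l (suc k)
    + sum (λ j → if D j then 0# else product (columnWeight D c (just j)) * rookSum (D ⊕ just j) (c ℤ.+ + 1) l k)
  rookSum-suc-suc {m} D c l k = begin
    rookSum D c (suc l) (suc k)                                        ≈⟨ sumOver-allPlacements-suc t ⟩
    sumOver Ps (λ P → t (nothing ∷ P) + sum (λ j → t (just j ∷ P)))    ≈⟨ sumOver-+ Ps _ _ ⟩
    sumOver Ps (λ P → t (nothing ∷ P)) + sumOver Ps (λ P → sum (λ j → t (just j ∷ P)))
      ≈⟨ +-cong (trans (sumOver-cong Ps (term-empty D c (suc k))) (sumOver-*ˡ Ps _ _))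
                (trans (sumOver-sum Ps (λ j P → t (just j ∷ P))) (sum-cong-≋ (λ j → trans (sumOver-cong Ps (term-rook D c k j)) (row j)))) ⟩
    product (columnWeight D c nothing) * rookSum D (c ℤ.+ + 1) l (suc k)
    + sum (λ j → if D j then 0# else product (columnWeight D c (just j)) * rookSum (D ⊕ just j) (c ℤ.+ + 1) l k) ∎
    where
    Ps = allPlacements l m
    t : Placement (suc l) m → Carrier
    t P = if validOn D (suc k) P then weightOn D c P else 0#
    row : ∀ j → sumOver Ps (λ P → if D j then 0# else product (columnWeight D c (just j))
                                   * (if validOn (D ⊕ just j) k P then weightOn (D ⊕ just j) (c ℤ.+ + 1) P else 0#))
                ≈ (if D j then 0# else product (columnWeight D c (just j)) * rookSum (D ⊕ just j) (c ℤ.+ + 1) l k)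
    row j with D j
    ... | true  = sumOver-zero Ps
    ... | false = sumOver-*ˡ Ps _ _

module RookSumClosedForm {c ℓ} (K : Field c ℓ) (a q : Field.Carrier K) where
  open import Data.Bool.Properties using (∨-identityʳ; ∨-zeroʳ)
  open Placements

  open Field K hiding (zero)
  open FieldOps K
  open IntegerCoefficients commutativeRing
  open FieldFacts K
  open QCalculus K q
  open RookSums K a q
  open import Algebra.Properties.Semiring.Sum semiring using (sum; sum-cong-≋; *-distribʳ-sum)
  open import Algebra.Properties.CommutativeMonoid.Sum *-commutativeMonoid using ()
    renaming (sum to product; sum-cong-≋ to product-cong)
  open import Relation.Binary.Reasoning.Setoid setoid
  open Data.Nat.Solver.+-*-Solver using () renaming (solve to solveℕ; _:=_ to _:=ℕ_; _:+_ to _:+ℕ_; _:*_ to _:*ℕ_; con to conℕ)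
  open Data.Integer.Solver.+-*-Solver using () renaming (solve to solveℤ; _:=_ to _:=ℤ_; _:+_ to _:+ℤ_; _:-_ to _:-ℤ_; _:*_ to _:*ℤ_; con to conℤ)

  -- The free rows are indexed by the pairs (s, b) of free rows above and below,
  -- which run over s + b = freeRows D - 1.
  sum-freeRows : ∀ {m} (D : RowSet m) (g : ℕ → ℕ → Carrier) →
    sum (λ j → if D j then 0# else g (freeAbove D j) (freeBelow D j)) ≈ antidiagonalSum (freeRows D) g
  sum-freeRows {zero}  D g = refl
  sum-freeRows {suc m} D g = trans (+-congʳ bottom-row) (step (D Fin.zero) g)
    where
    D′ = D ∘ Fin.suc
    bottom-row : (if D Fin.zero then 0# else g (freeAbove D Fin.zero) (freeBelow D Fin.zero))
               ≈ (if D Fin.zero then 0# else g (freeRows D′) 0)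
    bottom-row = reflexive (≡.cong (λ z → if D Fin.zero then 0# else g (freeRows D′) z) (freeBelow-zero D))
    step : ∀ b g → (if b then 0# else g (freeRows D′) 0)
                   + sum (λ j → if D′ j then 0# else g (freeAbove D′ j) ((if not b then 1 else 0) ℕ.+ freeBelow D′ j))
                 ≈ antidiagonalSum ((if not b then 1 else 0) ℕ.+ freeRows D′) g
    step true  g = trans (+-identityˡ _) (sum-freeRows D′ g)
    step false g = +-congˡ (sum-freeRows D′ (λ s b → g s (suc b)))

  product-freeRows : ∀ {m} (D : RowSet m) x →
    product (λ j → if D j then 1# else ω (x * q² ^ freeAbove D j)) ≈ ωProduct x (freeRows D)
  product-freeRows {zero}  D x = refl
  product-freeRows {suc m} D x = step (D Fin.zero)
    where
    D′ = D ∘ Fin.suc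
    step : ∀ b → (if b then 1# else ω (x * q² ^ freeRows D′)) * product (λ j → if D′ j then 1# else ω (x * q² ^ freeAbove D′ j))
                 ≈ ωProduct x ((if not b then 1 else 0) ℕ.+ freeRows D′)
    step true  = trans (*-identityˡ _) (product-freeRows D′ x)
    step false = trans (*-congˡ (product-freeRows D′ x)) (*-comm _ _)

  -- For the board with m rows whose first c columns are already filled,
  -- weights are expressed through x = a q^(2c+1-2m).
  exponent : ℕ → ℤ → ℤ
  exponent m c = (+ 2) ℤ.* c ℤ.+ (+ 1) ℤ.- (+ 2) ℤ.* (+ m)

  module _ (q≉0 : ¬ (q ≈ 0#)) where

    *-q²^ : ∀ {x E} → x ≈ a * q ^ᶻ E → ∀ s → x * q² ^ s ≈ a * q ^ᶻ (E ℤ.+ + (s ℕ.+ s))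
    *-q²^ {x} {E} x≈ s = begin
      x * q² ^ s                    ≈⟨ *-cong x≈ (trans (^-distrib-* q q s) (sym (^-+ q s s))) ⟩
      (a * q ^ᶻ E) * q ^ (s ℕ.+ s)  ≈⟨ *-assoc _ _ _ ⟩
      a * (q ^ᶻ E * q ^ (s ℕ.+ s))  ≈⟨ *-congˡ (^ᶻ-+ q≉0 E (s ℕ.+ s)) ⟨
      a * q ^ᶻ (E ℤ.+ + (s ℕ.+ s))  ∎

    exponent-suc : ∀ {m} c x → x ≈ a * q ^ᶻ (exponent m c) → x * q² ≈ a * q ^ᶻ (exponent m (c ℤ.+ + 1))
    exponent-suc {m} c x x≈ = trans (*-congˡ (sym (*-identityʳ q²))) (trans (*-q²^ {E = exponent m c} x≈ 1)
      (reflexive (≡.cong (λ w → a * q ^ᶻ w) (solveℤ 2 (λ c M →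
        (conℤ (+ 2) :*ℤ c :+ℤ conℤ (+ 1) :-ℤ conℤ (+ 2) :*ℤ M) :+ℤ conℤ (+ 2)
        :=ℤ conℤ (+ 2) :*ℤ (c :+ℤ conℤ (+ 1)) :+ℤ conℤ (+ 1) :-ℤ conℤ (+ 2) :*ℤ M) ≡.refl c (+ m)))))

    -- The cell (0, j) has weight index c - j - (rooks to its upper left), and
    -- 2 (c - j - occupiedAbove D j) ± 1 = 2c + 1 - 2m + 2 freeAbove D j ± 1 by rows-around.
    weight≈ω : ∀ {m} (D : RowSet m) c x → x ≈ a * q ^ᶻ (exponent m c) → ∀ j →
      weight a q ((c ℤ.- + toℕ j) ℤ.- + occupiedAbove D j) ≈ ω (x * q² ^ freeAbove D j)
    weight≈ω {m} D c x x≈ j = sym (*-congʳ (*-cong (+-congˡ (-‿cong numerator)) (⁻¹-cong (+-congˡ (-‿cong denominator)))))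
      where
      J = toℕ j
      A = occupiedAbove D j
      S = freeAbove D j
      z = (c ℤ.- + J) ℤ.- + A
      E = exponent m c ℤ.+ + (S ℕ.+ S)
      rows : (+ 1) ℤ.+ ((+ J ℤ.+ + A) ℤ.+ + S) ≡.≡ + m
      rows = ≡.cong (+_) (rows-around D j)
      index-1 : (+ 2) ℤ.* z ℤ.- (+ 1) ≡.≡ E
      index-1 = ≡.trans (solveℤ 4 (λ c J A S → conℤ (+ 2) :*ℤ ((c :-ℤ J) :-ℤ A) :-ℤ conℤ (+ 1) :=ℤ
                  (conℤ (+ 2) :*ℤ c :+ℤ conℤ (+ 1) :-ℤ conℤ (+ 2) :*ℤ (conℤ (+ 1) :+ℤ ((J :+ℤ A) :+ℤ S))) :+ℤ (S :+ℤ S)) ≡.refl c (+ J) (+ A) (+ S))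
                (≡.cong₂ (λ w v → ((+ 2) ℤ.* c ℤ.+ (+ 1) ℤ.- (+ 2) ℤ.* w) ℤ.+ v) rows (≡.sym (ℤP.pos-+ S S)))
      index+1 : (+ 2) ℤ.* z ℤ.+ (+ 1) ≡.≡ E ℤ.+ (+ 2)
      index+1 = ≡.trans (solveℤ 2 (λ z E → conℤ (+ 2) :*ℤ z :+ℤ conℤ (+ 1) :=ℤ (conℤ (+ 2) :*ℤ z :-ℤ conℤ (+ 1)) :+ℤ conℤ (+ 2)) ≡.refl z E)
                        (≡.cong (ℤ._+ (+ 2)) index-1)
      denominator : x * q² ^ S ≈ a * q ^ᶻ ((+ 2) ℤ.* z ℤ.- (+ 1))
      denominator = trans (*-q²^ {E = exponent m c} x≈ S) (reflexive (≡.cong (λ w → a * q ^ᶻ w) (≡.sym index-1)))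
      numerator : (x * q² ^ S) * q² ≈ a * q ^ᶻ ((+ 2) ℤ.* z ℤ.+ (+ 1))
      numerator = begin
        (x * q² ^ S) * q²          ≈⟨ *-cong (*-q²^ {E = exponent m c} x≈ S) (sym (*-congˡ (*-identityʳ q))) ⟩
        (a * q ^ᶻ E) * q ^ 2       ≈⟨ *-assoc _ _ _ ⟩
        a * (q ^ᶻ E * q ^ 2)       ≈⟨ *-congˡ (^ᶻ-+ q≉0 E 2) ⟨
        a * q ^ᶻ (E ℤ.+ + 2)       ≡⟨ ≡.cong (λ w → a * q ^ᶻ w) (≡.sym index+1) ⟩
        a * q ^ᶻ ((+ 2) ℤ.* z ℤ.+ (+ 1)) ∎

    private
      if-not : ∀ b {w w′ : Carrier} → (b ≡.≡ false → w ≈ w′) → (if not b then w else 1#) ≈ (if b then 1# else w′)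
      if-not true  _ = refl
      if-not false e = e ≡.refl

    columnWeight-empty : ∀ {m} (D : RowSet m) c x → x ≈ a * q ^ᶻ (exponent m c) →
      product (columnWeight D c nothing) ≈ ωProduct x (freeRows D)
    columnWeight-empty D c x x≈ = trans (product-cong (λ j → trans
      (reflexive (≡.cong (λ b → if not b then weight a q ((c ℤ.- + toℕ j) ℤ.- + occupiedAbove D j) else 1#) (∨-identityʳ (D j))))
      (if-not (D j) (λ _ → weight≈ω D c x x≈ j)))) (product-freeRows D x)

    -- Below the rook everything is cancelled, so only the free rows above j₀ contribute.
    columnWeight-rook : ∀ {m} (D : RowSet m) c x → x ≈ a * q ^ᶻ (exponent m c) → ∀ j₀ →
      product (columnWeight D c (just j₀)) ≈ ωProduct x (freeAbove D j₀)
    columnWeight-rook {m} D c x x≈ j₀ = trans (product-cong factor) (trans (product-freeRows D₂ x) (reflexive (≡.cong (ωProduct x) free₂)))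
      where
      D₂ : RowSet m
      D₂ j = D j ∨ not (toℕ j₀ <ᵇ toℕ j)
      not-D₂ : ∀ d g → not (d ∨ not g) ≡.≡ (g ∧ not d)
      not-D₂ d true  = ≡.cong not (∨-identityʳ d)
      not-D₂ d false = ≡.cong not (∨-zeroʳ d)
      free₂ : freeRows D₂ ≡.≡ freeAbove D j₀
      free₂ = count-cong (λ j → not-D₂ (D j) (toℕ j₀ <ᵇ toℕ j))
      D₂-free : ∀ d g → (d ∨ not g) ≡.≡ false → g ≡.≡ true
      D₂-free false true _ = ≡.refl
      freeAbove₂ : ∀ j → (toℕ j₀ <ᵇ toℕ j) ≡.≡ true → freeAbove D j ≡.≡ freeAbove D₂ j
      freeAbove₂ j j₀<j = count-cong same
        where
        same : ∀ j′ → ((toℕ j <ᵇ toℕ j′) ∧ not (D j′)) ≡.≡ ((toℕ j <ᵇ toℕ j′) ∧ not (D j′ ∨ not (toℕ j₀ <ᵇ toℕ j′)))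
        same j′ with toℕ j <ᵇ toℕ j′ in j<j′
        ... | false = ≡.refl
        ... | true  = ≡.trans (≡.cong not (≡.sym (∨-identityʳ (D j′))))
                        (≡.cong (λ u → not (D j′ ∨ not u)) (≡.sym (<ᵇ-trans (toℕ j₀) (toℕ j) (toℕ j′) j₀<j j<j′)))
      visible : ∀ e d l → (not e ∧ not (d ∨ l)) ≡.≡ not (d ∨ not (not e ∧ not l))
      visible true  true  l     = ≡.refl
      visible true  false true  = ≡.refl
      visible true  false false = ≡.refl
      visible false true  l     = ≡.refl
      visible false false true  = ≡.refl
      visible false false false = ≡.refl
      factor : ∀ j → columnWeight D c (just j₀) j ≈ (if D₂ j then 1# else ω (x * q² ^ freeAbove D₂ j))
      factor j = trans
        (reflexive (≡.cong (λ b → if b then weight a q ((c ℤ.- + toℕ j) ℤ.- + occupiedAbove D j) else 1#)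
          (≡.trans (visible (eqFin j j₀) (D j) (toℕ j <ᵇ toℕ j₀)) (≡.cong (λ g → not (D j ∨ not g)) (≢∧≮⇒> j j₀)))))
        (if-not (D₂ j) (λ D₂j≡false → trans (weight≈ω D c x x≈ j)
          (ω-cong (*-congˡ (reflexive (≡.cong (q² ^_) (freeAbove₂ j (D₂-free (D j) _ D₂j≡false))))))))

    module _ (a-generic : ∀ (n : ℤ) → ¬ (1# - a * q ^ᶻ n ≈ 0#)) where

      factor≉0 : ∀ {m} c x → x ≈ a * q ^ᶻ (exponent m c) → ∀ s → ¬ (1# - x * q² ^ s ≈ 0#)
      factor≉0 {m} c x x≈ s 1-xq²ˢ≈0 =
        a-generic (exponent m c ℤ.+ + (s ℕ.+ s)) (trans (+-congˡ (-‿cong (sym (*-q²^ {E = exponent m c} x≈ s)))) 1-xq²ˢ≈0)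

      -- Strengthened for the induction on l to every filling D of the columns to the left.
      ClosedFormAt : ℕ → Set _
      ClosedFormAt l = ∀ {m} (D : RowSet m) c k d x → freeRows D ≡.≡ k ℕ.+ d → x ≈ a * q ^ᶻ (exponent m c) →
        rookSum D c l k * (q ^ (l ℕ.* (k ℕ.+ d)) * poch x q² (k ℕ.+ d)) ≈ closedForm x d l k

      closedForm-0 : ClosedFormAt 0
      closedForm-0 D c zero d x _ _ = trans
        (solve 1 (λ Pp → (con (+ 1) :+ con (+ 0)) :* (con (+ 1) :* Pp) := con (+ 1) :* con (+ 1) :* con (+ 1) :* con (+ 1) :* Pp) refl (poch x q² d))
        (*-congˡ (poch-cong q² d (sym (*-identityʳ x))))
      closedForm-0 D c (suc k) d x _ _ =
        solve 5 (λ M A B C E → (con (+ 0) :+ con (+ 0)) :* M := A :* con (+ 0) :* B :* C :* E) refl _ _ _ _ _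

      module _ {l} (IH : ClosedFormAt l) where

        empty-column : ∀ {m} (D : RowSet m) c k d x → freeRows D ≡.≡ k ℕ.+ d → x ≈ a * q ^ᶻ (exponent m c) →
          (product (columnWeight D c nothing) * rookSum D (c ℤ.+ + 1) l k) * (q ^ (suc l ℕ.* (k ℕ.+ d)) * poch x q² (k ℕ.+ d))
            ≈ closedForm (x * q²) d l k
        empty-column {m} D c k d x free x≈ = begin
          (product (columnWeight D c nothing) * F) * (q ^ (n ℕ.+ l ℕ.* n) * poch x q² n)
            ≈⟨ *-cong (*-congʳ (trans (columnWeight-empty D c x x≈) (reflexive (≡.cong (ωProduct x) free)))) (*-congʳ (^-+ q n (l ℕ.* n))) ⟩
          (ωProduct x n * F) * ((q ^ n * q ^ (l ℕ.* n)) * poch x q² n)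
            ≈⟨ solve 5 (λ O Fp Qn Ql Pp → (O :* Fp) :* ((Qn :* Ql) :* Pp) := Fp :* (Ql :* (O :* (Qn :* Pp))))
                 refl (ωProduct x n) F (q ^ n) (q ^ (l ℕ.* n)) (poch x q² n) ⟩
          F * (q ^ (l ℕ.* n) * (ωProduct x n * (q ^ n * poch x q² n)))
            ≈⟨ *-congˡ (*-congˡ (ωProduct-shifts-poch q≉0 (factor≉0 {m} c x x≈) n)) ⟩
          F * (q ^ (l ℕ.* n) * poch (x * q²) q² n)
            ≈⟨ IH D (c ℤ.+ + 1) k d (x * q²) free (exponent-suc {m} c x x≈) ⟩
          closedForm (x * q²) d l k ∎
          where
          n = k ℕ.+ d
          F = rookSum D (c ℤ.+ + 1) l k

        rook-row : ∀ {m} (D : RowSet m) c k d x → freeRows D ≡.≡ suc (k ℕ.+ d) → x ≈ a * q ^ᶻ (exponent m c) →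
          ∀ j → D j ≡.≡ false →
          (product (columnWeight D c (just j)) * rookSum (D ⊕ just j) (c ℤ.+ + 1) l k)
            * (q ^ (suc l ℕ.* suc (k ℕ.+ d)) * poch x q² (suc (k ℕ.+ d)))
            ≈ closedForm (x * q²) d l k * ((1# - x * q² ^ freeAbove D j) * q ^ (freeBelow D j ℕ.+ suc l))
        rook-row {m} D c k d x free x≈ j j-free = begin
          (product (columnWeight D c (just j)) * F) * (q ^ (suc l ℕ.* suc n) * poch x q² (suc n))
            ≈⟨ *-cong (*-congʳ (columnWeight-rook D c x x≈ j))
                      (*-cong (trans (reflexive (≡.cong (q ^_) exponents)) (trans (^-+ q s _) (*-congˡ (^-+ q (b ℕ.+ suc l) (l ℕ.* n)))))
                              (poch-unfoldˡ x q² n)) ⟩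
          (ωProduct x s * F) * ((q ^ s * (q ^ (b ℕ.+ suc l) * q ^ (l ℕ.* n))) * ((1# - x) * poch (x * q²) q² n))
            ≈⟨ solve 7 (λ O Fp Qs Qb Ql V Pp → (O :* Fp) :* ((Qs :* (Qb :* Ql)) :* (V :* Pp))
                         := (Fp :* (Ql :* Pp)) :* ((O :* (Qs :* V)) :* Qb))
                 refl (ωProduct x s) F (q ^ s) (q ^ (b ℕ.+ suc l)) (q ^ (l ℕ.* n)) (1# - x) (poch (x * q²) q² n) ⟩
          (F * (q ^ (l ℕ.* n) * poch (x * q²) q² n)) * ((ωProduct x s * (q ^ s * (1# - x))) * q ^ (b ℕ.+ suc l))
            ≈⟨ *-cong (IH (D ⊕ just j) (c ℤ.+ + 1) k d (x * q²) free′ (exponent-suc {m} c x x≈))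
                      (*-congʳ (ωProduct-telescopes q≉0 (factor≉0 {m} c x x≈) s)) ⟩
          closedForm (x * q²) d l k * ((1# - x * q² ^ s) * q ^ (b ℕ.+ suc l)) ∎
          where
          n = k ℕ.+ d
          s = freeAbove D j
          b = freeBelow D j
          F = rookSum (D ⊕ just j) (c ℤ.+ + 1) l k
          free′ : freeRows (D ⊕ just j) ≡.≡ k ℕ.+ d
          free′ = ℕP.suc-injective (≡.trans (≡.sym (freeRows-⊕ D j j-free)) free)
          s+b : s ℕ.+ b ≡.≡ n
          s+b = ℕP.suc-injective (≡.trans (free-around D j j-free) free)
          exponents : suc l ℕ.* suc n ≡.≡ s ℕ.+ ((b ℕ.+ suc l) ℕ.+ l ℕ.* n)
          exponents = ≡.trans (≡.cong (λ w → suc l ℕ.* suc w) (≡.sym s+b))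
                   (≡.trans (solveℕ 3 (λ L S B → (conℕ 1 :+ℕ L) :*ℕ (conℕ 1 :+ℕ (S :+ℕ B))
                                :=ℕ S :+ℕ ((B :+ℕ (conℕ 1 :+ℕ L)) :+ℕ L :*ℕ (S :+ℕ B))) ≡.refl l s b)
                            (≡.cong (λ w → s ℕ.+ ((b ℕ.+ suc l) ℕ.+ l ℕ.* w)) s+b))

        rook-columns : ∀ {m} (D : RowSet m) c k d x → freeRows D ≡.≡ suc (k ℕ.+ d) → x ≈ a * q ^ᶻ (exponent m c) →
          sum (λ j → if D j then 0# else product (columnWeight D c (just j)) * rookSum (D ⊕ just j) (c ℤ.+ + 1) l k)
            * (q ^ (suc l ℕ.* suc (k ℕ.+ d)) * poch x q² (suc (k ℕ.+ d)))
            ≈ (q ^ suc l * qnum (suc (k ℕ.+ d)) * (1# - x * q ^ (k ℕ.+ d))) * closedForm (x * q²) d l k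
        rook-columns {m} D c k d x free x≈ = begin
          sum (λ j → if D j then 0# else t j) * M                         ≈⟨ *-distribʳ-sum M (λ j → if D j then 0# else t j) ⟩
          sum (λ j → (if D j then 0# else t j) * M)                       ≈⟨ sum-cong-≋ row ⟩
          sum (λ j → if D j then 0# else g (freeAbove D j) (freeBelow D j)) ≈⟨ sum-freeRows D g ⟩
          antidiagonalSum (freeRows D) g                                  ≡⟨ ≡.cong (λ w → antidiagonalSum w g) free ⟩
          antidiagonalSum (suc n) g                                       ≈⟨ antidiagonalSum-*ˡ (suc n) closed (λ s b → (1# - x * q² ^ s) * q ^ (b ℕ.+ suc l)) ⟩
          closed * antidiagonalSum (suc n) (λ s b → (1# - x * q² ^ s) * q ^ (b ℕ.+ suc l))
                                                                          ≈⟨ *-congˡ (antidiagonalSum-geometric-suc q≉0 n x (suc l)) ⟩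
          closed * (q ^ suc l * qnum (suc n) * (1# - x * q ^ n))           ≈⟨ *-comm closed _ ⟩
          (q ^ suc l * qnum (suc n) * (1# - x * q ^ n)) * closed           ∎
          where
          n = k ℕ.+ d
          M = q ^ (suc l ℕ.* suc n) * poch x q² (suc n)
          t : Fin m → Carrier
          t j = product (columnWeight D c (just j)) * rookSum (D ⊕ just j) (c ℤ.+ + 1) l k
          closed = closedForm (x * q²) d l k
          g : ℕ → ℕ → Carrier
          g s b = closed * ((1# - x * q² ^ s) * q ^ (b ℕ.+ suc l))
          row : ∀ j → (if D j then 0# else t j) * M ≈ (if D j then 0# else g (freeAbove D j) (freeBelow D j))
          row j with D j in j-occupied
          ... | true  = zeroˡ M
          ... | false = rook-row D c k d x free x≈ j j-occupied

      closedForm-suc : ∀ {l} → ClosedFormAt l → ClosedFormAt (suc l)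
      closedForm-suc {l} IH D c zero d x free x≈ = begin
        rookSum D c (suc l) 0 * M                                                 ≈⟨ *-congʳ (rookSum-suc-zero D c l) ⟩
        (product (columnWeight D c nothing) * rookSum D (c ℤ.+ + 1) l 0) * M       ≈⟨ empty-column {l} IH D c 0 d x free x≈ ⟩
        closedForm (x * q²) d l 0                                                 ≈⟨ closedForm-suc-0 x d l ⟨
        closedForm x d (suc l) 0                                                  ∎
        where M = q ^ (suc l ℕ.* d) * poch x q² d
      closedForm-suc {l} IH D c (suc k) d x free x≈ = begin
        rookSum D c (suc l) (suc k) * M  ≈⟨ *-congʳ (rookSum-suc-suc D c l k) ⟩
        (empty + occupied) * M           ≈⟨ distribʳ M empty occupied ⟩
        empty * M + occupied * M         ≈⟨ +-cong (empty-column {l} IH D c (suc k) d x free x≈) (rook-columns {l} IH D c k d x free x≈) ⟩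
        closedForm (x * q²) d l (suc k)
          + (q ^ suc l * qnum (suc (k ℕ.+ d)) * (1# - x * q ^ (k ℕ.+ d))) * closedForm (x * q²) d l k
                                         ≈⟨ closedForm-suc-suc x d l k ⟨
        closedForm x d (suc l) (suc k)   ∎
        where
        M = q ^ (suc l ℕ.* suc (k ℕ.+ d)) * poch x q² (suc (k ℕ.+ d))
        empty = product (columnWeight D c nothing) * rookSum D (c ℤ.+ + 1) l (suc k)
        occupied = sum (λ j → if D j then 0# else product (columnWeight D c (just j)) * rookSum (D ⊕ just j) (c ℤ.+ + 1) l k)

      closedForm-holds : ∀ l → ClosedFormAt l
      closedForm-holds zero    = closedForm-0
      closedForm-holds (suc l) = closedForm-suc (closedForm-holds l)

open Data.Integer.Solver.+-*-Solver using () renaming (solve to solveℤ; _:=_ to _:=ℤ_; _:+_ to _:+ℤ_; _:-_ to _:-ℤ_; _:*_ to _:*ℤ_; con to conℤ)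

-- With m = k + d and l + d = t + 1, the exponent of the q-Pochhammer symbol
-- (a q^(l-m-k); q)_k is that of x q^t for x = a q^(1-2m).
exponent-shift : ∀ l k d t → suc t ≡.≡ l ℕ.+ d →
  ((+ 1) ℤ.- (+ 2) ℤ.* (+ (k ℕ.+ d))) ℤ.+ (+ t) ≡.≡ ((+ l) ℤ.- (+ (k ℕ.+ d))) ℤ.- (+ k)
exponent-shift l k d t l+d = begin
  ((+ 1) ℤ.- (+ 2) ℤ.* (+ (k ℕ.+ d))) ℤ.+ T   ≡⟨ ≡.cong (λ w → ((+ 1) ℤ.- (+ 2) ℤ.* w) ℤ.+ T) (ℤP.pos-+ k d) ⟩
  ((+ 1) ℤ.- (+ 2) ℤ.* (K′ ℤ.+ D′)) ℤ.+ T      ≡⟨ solveℤ 3 (λ K D T → ((conℤ (+ 1) :-ℤ conℤ (+ 2) :*ℤ (K :+ℤ D)) :+ℤ T)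
                                                  :=ℤ (conℤ (+ 1) :+ℤ T) :-ℤ conℤ (+ 2) :*ℤ (K :+ℤ D)) ≡.refl K′ D′ T ⟩
  ((+ 1) ℤ.+ T) ℤ.- (+ 2) ℤ.* (K′ ℤ.+ D′)      ≡⟨ ≡.cong (λ w → w ℤ.- (+ 2) ℤ.* (K′ ℤ.+ D′)) l+d′ ⟩
  (L ℤ.+ D′) ℤ.- (+ 2) ℤ.* (K′ ℤ.+ D′)         ≡⟨ solveℤ 3 (λ L K D → (L :+ℤ D) :-ℤ conℤ (+ 2) :*ℤ (K :+ℤ D)
                                                  :=ℤ (L :-ℤ (K :+ℤ D)) :-ℤ K) ≡.refl L K′ D′ ⟩
  (L ℤ.- (K′ ℤ.+ D′)) ℤ.- K′                   ≡⟨ ≡.cong (λ w → (L ℤ.- w) ℤ.- K′) (ℤP.pos-+ k d) ⟨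
  (L ℤ.- (+ (k ℕ.+ d))) ℤ.- K′                 ∎
  where
  open ≡.≡-Reasoning
  K′ = + k
  D′ = + d
  T = + t
  L = + l
  l+d′ : (+ 1) ℤ.+ T ≡.≡ L ℤ.+ D′
  l+d′ = ≡.trans (≡.cong +_ l+d) (ℤP.pos-+ l d)

module RectangularBoard {c ℓ} (K : Field c ℓ) (a q : Field.Carrier K)
  (q≉0 : ¬ (Field._≈_ K q (Field.0# K)))
  (q^≉1 : ∀ n → ¬ (Field._≈_ K (FieldOps._^_ K q (suc n)) (Field.1# K)))
  (a-generic : ∀ (n : ℤ) → ¬ (Field._≈_ K (Field._-_ K (Field.1# K) (Field._*_ K a (FieldOps._^ᶻ_ K q n))) (Field.0# K))) where

  open Field K hiding (zero)
  open FieldOps K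
  open Rook K
  open IntegerCoefficients commutativeRing
  open FieldFacts K
  open QCalculus K q
  open Placements using (count-true)
  open RookSums K a q
  open RookSumClosedForm K a q
  open import Relation.Binary.Reasoning.Setoid setoid

  *-q^ : ∀ E n → (a * q ^ᶻ E) * q ^ n ≈ a * q ^ᶻ (E ℤ.+ + n)
  *-q^ E n = trans (*-assoc _ _ _) (*-congˡ (sym (^ᶻ-+ q≉0 E n)))

  poch-q-argument : ∀ l k d → gauss l k * poch (a * q ^ᶻ ((+ l) ℤ.- (+ (k ℕ.+ d)) ℤ.- (+ k))) q k
                    ≈ gauss l k * poch ((a * q ^ᶻ ((+ 1) ℤ.- (+ 2) ℤ.* (+ (k ℕ.+ d)))) * q ^ ((l ℕ.+ d) ℕ.∸ 1)) q k
  poch-q-argument l zero    d = refl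
  poch-q-argument l (suc k) d with l ℕ.+ d in l+d
  ... | zero with ≡.refl ← ℕP.m+n≡0⇒m≡0 l l+d = trans (zeroˡ _) (sym (zeroˡ _))
  ... | suc t = *-congˡ (poch-cong q (suc k) (sym (trans (*-q^ ((+ 1) ℤ.- (+ 2) ℤ.* (+ (suc k ℕ.+ d))) t)
                  (reflexive (≡.cong (λ w → a * q ^ᶻ w) (exponent-shift l (suc k) d t (≡.sym l+d)))))))

  rectangleFormula : ℕ → ℕ → ℕ → Carrier
  rectangleFormula l m k =
    q ^ᶻ ((+ ((suc k) C 2)) ℤ.- (+ (l ℕ.* m)))
      * qbinom q l k
      * (qfact q m / qfact q (m ℕ.∸ k))
      * ((poch (a * (q ^ᶻ ((+ l) ℤ.- (+ m) ℤ.- (+ k)))) q k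
          * poch (a * (q ^ᶻ ((+ 1) ℤ.+ (+ 2) ℤ.* (+ l) ℤ.- (+ 2) ℤ.* (+ m)))) (q * q) (m ℕ.∸ k))
         / poch (a * (q ^ᶻ ((+ 1) ℤ.- (+ 2) ℤ.* (+ m)))) (q * q) m)

  module _ (l k d : ℕ) where

    private
      m = k ℕ.+ d
      x = a * q ^ᶻ ((+ 1) ℤ.- (+ 2) ℤ.* (+ m))
      Q = q ^ᶻ ((+ ((suc k) C 2)) ℤ.- (+ (l ℕ.* m)))
      p₁ = poch (a * (q ^ᶻ ((+ l) ℤ.- (+ m) ℤ.- (+ k)))) q k
      p₂ = poch (a * (q ^ᶻ ((+ 1) ℤ.+ (+ 2) ℤ.* (+ l) ℤ.- (+ 2) ℤ.* (+ m)))) q² (m ℕ.∸ k)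
      pₘ = poch x q² m
      M = q ^ (l ℕ.* m) * pₘ

      pₘ≉0 : ¬ (pₘ ≈ 0#)
      pₘ≉0 = poch-≉0 (factor≉0 q≉0 a-generic {m} (+ 0) x refl) m

      Q-scaled : Q * q ^ (l ℕ.* m) ≈ q ^ triangular k
      Q-scaled = trans (sym (^ᶻ-+ q≉0 ((+ ((suc k) C 2)) ℤ.- (+ (l ℕ.* m))) (l ℕ.* m))) (reflexive (≡.trans
        (≡.cong (q ^ᶻ_) (solveℤ 2 (λ T L → (T :-ℤ L) :+ℤ L :=ℤ T) ≡.refl (+ ((suc k) C 2)) (+ (l ℕ.* m))))
        (≡.cong (q ^_) (≡.sym (triangular≡C2 k)))))

      p₂≈ : p₂ ≈ poch (x * q² ^ l) q² d
      p₂≈ = trans (reflexive (≡.cong (poch _ q²) (ℕP.m+n∸m≡n k d)))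
        (poch-cong q² d (sym (trans (*-q²^ q≉0 {E = (+ 1) ℤ.- (+ 2) ℤ.* (+ m)} refl l)
          (reflexive (≡.cong (λ w → a * q ^ᶻ w) (≡.trans (≡.cong (λ w → ((+ 1) ℤ.- (+ 2) ℤ.* (+ m)) ℤ.+ w) (ℤP.pos-+ l l))
            (solveℤ 2 (λ L M → (conℤ (+ 1) :-ℤ conℤ (+ 2) :*ℤ M) :+ℤ (L :+ℤ L)
                           :=ℤ conℤ (+ 1) :+ℤ conℤ (+ 2) :*ℤ L :-ℤ conℤ (+ 2) :*ℤ M) ≡.refl (+ l) (+ m))))))))

    rectangleFormula-scaled : rectangleFormula l m k * M ≈ closedForm x d l k
    rectangleFormula-scaled = begin
      (Q * qb * fr * ((p₁ * p₂) * pₘ ⁻¹)) * (q ^ (l ℕ.* m) * pₘ)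
        ≈⟨ ≈-modulo₁ (solve 8 (λ Qz Qb Fr P1 P2 I Ql Pm → (Qz :* Qb :* Fr :* ((P1 :* P2) :* I)) :* (Ql :* Pm)
                := ((Qz :* Ql) :* Qb :* Fr :* (P1 :* P2)) :+ ((Qz :* Ql) :* Qb :* Fr :* (P1 :* P2)) :* (Pm :* I :- con (+ 1)))
                refl Q qb fr p₁ p₂ (pₘ ⁻¹) (q ^ (l ℕ.* m)) pₘ) (⁻¹-inverseʳ pₘ pₘ≉0) ⟩
      (Q * q ^ (l ℕ.* m)) * qb * fr * (p₁ * p₂)
        ≈⟨ *-cong (*-cong (*-cong Q-scaled (qbinom≈gauss q≉0 q^≉1 l k)) (qfact-ratio≈qfalling q≉0 q^≉1 k d)) (*-congˡ p₂≈) ⟩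
      T * gauss l k * qfalling k d * (p₁ * p₂′)
        ≈⟨ solve 5 (λ A G F P1 P2 → A :* G :* F :* (P1 :* P2) := (A :* F :* P2) :* (G :* P1)) refl T (gauss l k) (qfalling k d) p₁ p₂′ ⟩
      (T * qfalling k d * p₂′) * (gauss l k * p₁)
        ≈⟨ *-congˡ (poch-q-argument l k d) ⟩
      (T * qfalling k d * p₂′) * (gauss l k * p₁′)
        ≈⟨ solve 5 (λ A G F P1 P2 → (A :* F :* P2) :* (G :* P1) := A :* G :* F :* P1 :* P2) refl T (gauss l k) (qfalling k d) p₁′ p₂′ ⟩
      closedForm x d l k ∎
      where
      qb = qbinom q l k
      fr = qfact q m / qfact q (m ℕ.∸ k)
      T = q ^ triangular k
      p₁′ = poch (x * q ^ ((l ℕ.+ d) ℕ.∸ 1)) q k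
      p₂′ = poch (x * q² ^ l) q² d

    rookNumber≈rectangleFormula : rookNumber a q l m k ≈ rectangleFormula l m k
    rookNumber≈rectangleFormula = begin
      rookNumber a q l m k                  ≈⟨ rookNumber≈rookSum l m k ⟩
      rookSum (λ _ → false) (+ 0) l k        ≈⟨ *-cancelʳ-≉0 (*-≉0 (^-≉0 q≉0 (l ℕ.* m)) pₘ≉0)
           (trans (closedForm-holds q≉0 a-generic l (λ _ → false) (+ 0) k d x count-true refl) (sym rectangleFormula-scaled)) ⟩
      rectangleFormula l m k                ∎

proposition3p11 : ∀ {c ℓ} (K : Field c ℓ) →
  let open Field K
      open FieldOps K
      open Rook K
  in
  (a q : Carrier) →
  ¬ (q ≈ 0#) →
  (∀ n → ¬ ((q ^ suc n) ≈ 1#)) →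
  (∀ (n : ℤ) → ¬ ((1# - a * (q ^ᶻ n)) ≈ 0#)) →
  (l m k : ℕ) → k ≤ m →
  rookNumber a q l m k ≈
    q ^ᶻ ((+ ((suc k) C 2)) ℤ.- (+ (l ℕ.* m)))
      * qbinom q l k
      * (qfact q m / qfact q (m ℕ.∸ k))
      * ((poch (a * (q ^ᶻ ((+ l) ℤ.- (+ m) ℤ.- (+ k)))) q k
          * poch (a * (q ^ᶻ ((+ 1) ℤ.+ (+ 2) ℤ.* (+ l) ℤ.- (+ 2) ℤ.* (+ m)))) (q * q) (m ℕ.∸ k))
         / poch (a * (q ^ᶻ ((+ 1) ℤ.- (+ 2) ℤ.* (+ m)))) (q * q) m)
proposition3p11 K a q q≉0 q^≉1 a-generic l m k k≤m with ℕP.m≤n⇒∃[o]m+o≡n k≤m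
... | d , ≡.refl = RectangularBoard.rookNumber≈rectangleFormula K a q q≉0 q^≉1 a-generic l k d
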